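{- Let $\Delta$ be a Markov triangle representing the Markov triple $(p_1,p_2,p_3)$, and let $\beta$ be the integral barycentre of $\Delta$. Then for each $i\in\{1,2,3\}$, $\beta$ is also the integral barycentre of $M_{p_i,\Delta}(\Delta)$, the image of $\Delta$ under its geometric mutation at the $p_i$-vertex.
   Context: Integral affine notions: for distinct rational points $p,p'$, $v_{p,p'}$ is the unique integral vector with coprime coordinates that is a positive multiple of $p'-p$, and the affine length of $[p,p']$ is the $r>0$ with $p'-p=r\,v_{p,p'}$. For a triangle with vertex $p$ and other vertices $p',p''$, the determinant of the angle at $p$ is $|\det(v_{p,p'},v_{p,p''})|$; the integral bisector at $p$ is the line through $p$ spanned by $v_{p,p'}+v_{p,p''}$, and $v_p$ is the primitive integral vector that is a positive multiple of $v_{p,p'}+v_{p,p''}$. The three integral bisectors meet in one point, the integral barycentre. For $v\in\mathbb{Z}^2$, $\varphi_v(u)=u+\det(v,u)v$, and the half-shear is $\varphi_v^{1/2}(u)=\varphi_v(u)$ if $\det(u,v)\ge0$, $\varphi_v^{1/2}(u)=u$ otherwise. The geometric mutation of a triangle $\Delta$ at its vertex $p$ is $M_{p,\Delta}=T_p\circ\varphi^{1/2}_{v_p}\circ T_{ -p}$, with $T_w$ the translation by $w$. Markov triples: positive integers with $p_1^2+p_2^2+p_3^2=3p_1p_2p_3$; mutation at $p_2$ replaces $p_2$ by $3p_1p_3-p_2$. Markov triangles (vertices labeled by the entries) are defined recursively: a Markov triangle representing $(1,1,1)$ is any triangle whose edges all have affine length $1$ and whose angles all have determinant $1$; if $\Delta$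 represents $(p_1,p_2,p_3)$ then $M_{p_2,\Delta}(\Delta)$ is a triangle representing $(p_1,3p_1p_3-p_2,p_3)$, its vertex lying on the integral bisector at the old $p_2$-vertex being labeled $3p_1p_3-p_2$, and the images of the $p_1$- and $p_3$-vertices keeping their labels. -}

module Defs where

open import Data.Nat as ℕ using (ℕ)
open import Data.Nat.GCD using (gcd)
open import Data.Integer as ℤ using (ℤ; ∣_∣)
open import Data.Rational as ℚ using (ℚ; 0ℚ; 1ℚ; _/_)
open import Data.Rational.Properties using (_≤?_)
open import Data.Fin using (Fin; zero; suc; _≟_)
open import Data.Product using (Σ; _×_; _,_; ∃; ∃-syntax)
open import Relation.Nullary using (¬_; yes; no)
open import Relation.Binary.PropositionalEquality using (_≡_)
open import Function.Bundles using (_⇔_)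

record Pt : Set where
  constructor pt
  field
    px : ℚ
    py : ℚ
open Pt public

record Vec2 : Set where
  constructor vec
  field
    vx : ℤ
    vy : ℤ
open Vec2 public

toℚ : ℤ → ℚ
toℚ z = z / 1

Primitive : Vec2 → Set
Primitive v = gcd ∣ vx v ∣ ∣ vy v ∣ ≡ 1

_⊕_ : Pt → Pt → Pt
p ⊕ q = pt (px p ℚ.+ px q) (py p ℚ.+ py q)

_⊖_ : Pt → Pt → Pt
p ⊖ q = pt (px p ℚ.- px q) (py p ℚ.- py q)

_·_ : ℚ → Vec2 → Pt
r · v = pt (r ℚ.* toℚ (vx v)) (r ℚ.* toℚ (vy v))

_+v_ : Vec2 → Vec2 → Vec2
v +v w = vec (vx v ℤ.+ vx w) (vy v ℤ.+ vy w)

detℤ : Vec2 → Vec2 → ℤ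
detℤ v w = vx v ℤ.* vy w ℤ.- vy v ℤ.* vx w

det-vu : Vec2 → Pt → ℚ
det-vu v u = toℚ (vx v) ℚ.* py u ℚ.- toℚ (vy v) ℚ.* px u

det-uv : Pt → Vec2 → ℚ
det-uv u v = px u ℚ.* toℚ (vy v) ℚ.- py u ℚ.* toℚ (vx v)

-- Dir p p' v : v = v_{p,p'}, the primitive integral vector which is a
-- positive multiple of p' - p  (its existence forces p ≠ p').
Dir : Pt → Pt → Vec2 → Set
Dir p p' v = Primitive v × (∃[ r ] (0ℚ ℚ.< r × p' ⊖ p ≡ r · v))

AffLen1 : Pt → Pt → Set
AffLen1 p p' = ∃[ v ] (Dir p p' v × p' ⊖ p ≡ 1ℚ · v)

φ : Vec2 → Pt → Pt
φ v u = u ⊕ (det-vu v u · v)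

halfShear : Vec2 → Pt → Pt
halfShear v u with 0ℚ ≤? det-uv u v
... | yes _ = φ v u
... | no  _ = u

mutMap : Vec2 → Pt → Pt → Pt
mutMap v p x = p ⊕ halfShear v (x ⊖ p)

Tri : Set
Tri = Fin 3 → Pt

nxt : Fin 3 → Fin 3
nxt zero = suc zero
nxt (suc zero) = suc (suc zero)
nxt (suc (suc zero)) = zero

AngleDet1 : Tri → Fin 3 → Set
AngleDet1 T i = ∃[ v ] ∃[ w ] (Dir (T i) (T (nxt i)) v × Dir (T i) (T (nxt (nxt i))) w
                               × ∣ detℤ v w ∣ ≡ 1)

BisVec : Tri → Fin 3 → Vec2 → Set
BisVec T i u = ∃[ v ] ∃[ w ] (Dir (T i) (T (nxt i)) v × Dir (T i) (T (nxt (nxt i))) w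
                 × Primitive u × ∃[ r ] (0ℚ ℚ.< r × ((1ℚ · (v +v w)) ≡ r · u)))

OnBisector : Tri → Fin 3 → Pt → Set
OnBisector T i x = ∃[ u ] (BisVec T i u × ∃[ t ] (x ≡ T i ⊕ (t · u)))

IsBarycentre : Tri → Pt → Set
IsBarycentre T β = (i : Fin 3) → OnBisector T i β

InTri : Tri → Pt → Set
InTri T x = Σ (Fin 3 → ℚ) λ l → ((∀ j → 0ℚ ℚ.≤ l j) × (l zero ℚ.+ l (suc zero) ℚ.+ l (suc (suc zero)) ≡ 1ℚ)
   × x ≡ pt (l zero ℚ.* px (T zero) ℚ.+ l (suc zero) ℚ.* px (T (suc zero)) ℚ.+ l (suc (suc zero)) ℚ.* px (T (suc (suc zero))))
            (l zero ℚ.* py (T zero) ℚ.+ l (suc zero) ℚ.* py (T (suc zero)) ℚ.+ l (suc (suc zero)) ℚ.* py (T (suc (suc zero)))))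

-- IsMutation T i T' : T' is the triangle M_{T i, T}(T), with vertex labelling:
-- T' j = M(T j) for j ≠ i, and T' i is the vertex lying on the integral
-- bisector at T i; the image M(T) as a point set equals the triangle T'.
IsMutation : Tri → Fin 3 → Tri → Set
IsMutation T i T' = ∃[ u ] (BisVec T i u
  × ((j : Fin 3) → ¬ (j ≡ i) → T' j ≡ mutMap u (T i) (T j))
  × (∃[ t ] (T' i ≡ T i ⊕ (t · u)))
  × ((x : Pt) → InTri T' x ⇔ (∃[ y ] (InTri T y × x ≡ mutMap u (T i) y))))

mutTriple : (Fin 3 → ℕ) → Fin 3 → Fin 3 → ℕ
mutTriple q i j with j ≟ i
... | yes _ = 3 ℕ.* q (nxt i) ℕ.* q (nxt (nxt i)) ℕ.∸ q i
... | no  _ = q j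

-- MarkovTriangle T q : T is a Markov triangle representing the triple q,
-- vertex T j carrying label q j.
data MarkovTriangle : Tri → (Fin 3 → ℕ) → Set where
  base : (T : Tri) → ((i : Fin 3) → AffLen1 (T i) (T (nxt i)))
       → ((i : Fin 3) → AngleDet1 T i) → MarkovTriangle T (λ _ → 1)
  mutate : (T : Tri) (q : Fin 3 → ℕ) (i : Fin 3) (T' : Tri)
         → MarkovTriangle T q → IsMutation T i T' → MarkovTriangle T' (mutTriple q i)

-- Place the corner at the mutated vertex p so that, for the bisector direction k at p,
-- α = det (A - p) k, β = det k (B - p) and D = det (A - p) (B - p) are positive (a degenerate
-- corner admits no barycentre). The half-shear is the shear φ about p on the side of A, the
-- identity on the side of B, and the identity on the bisector line p + ℚ k. Comparing the two
-- triangles at a few points of that line forces D = α β and puts the new apex X on the side AB.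
-- Then p lies on the new side from A* = φ A to B, so the angle at B keeps its sides, the angle
-- at A* is the φ-image of the angle at A, and the sides at X run along B - A and φ (A - B),
-- whose integral bisector is the bisector line at p reversed. The barycentre lies on that line,
-- where φ is the identity, so it lies on all three new bisectors.

module Submission where

open import Defs
open import Level using (0ℓ)
open import Data.Empty using (⊥; ⊥-elim)
open import Data.Fin using (Fin; zero; suc)
open import Data.Integer as ℤ using (ℤ; +_; +[1+_])
import Data.Integer.Properties as ℤ
open import Data.Integer.Tactic.RingSolver as ℤ-Solver using ()
open import Data.List using (List; _∷_; [])
open import Data.Nat as ℕ using (ℕ; suc)
import Data.Nat.Properties as ℕ
open import Data.Nat.GCD using (gcd; c*gcd[m,n]≡gcd[cm,cn]; gcd[0,0]≡0; gcd[m,n]∣m; gcd[m,n]∣n; gcd-greatest)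
import Data.Nat.Divisibility as ℕ
import Data.Integer.Divisibility.Signed as ℤ
open import Data.Product using (_×_; _,_; proj₁; proj₂; ∃; ∃-syntax)
open import Data.Rational as ℚ using (ℚ; mkℚ; 0ℚ; 1ℚ; _+_; _*_; _-_; -_; _≤_; _<_; 1/_; ↥_; ↧_; toℚᵘ; positive; nonNegative; NonZero)
open import Data.Rational.Properties
import Data.Rational.Unnormalised as ℚᵘ
import Data.Rational.Unnormalised.Properties as ℚᵘ
open import Data.Sum using (_⊎_; inj₁; inj₂)
open import Function.Base using (_∘_)
open import Function.Bundles using (_⇔_; mk⇔; Equivalence)
open import Relation.Binary.Definitions using (tri<; tri≈; tri>) renaming (Tri to Trichotomy)
open import Relation.Binary.PropositionalEquality
open import Relation.Nullary using (¬_; yes; no)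
open import Relation.Nullary.Decidable.Core using (dec⇒maybe)
open import Tactic.RingSolver using (solve-∀; solve)
open import Tactic.RingSolver.Core.AlmostCommutativeRing using (AlmostCommutativeRing; fromCommutativeRing)

ℚ-ring : AlmostCommutativeRing 0ℓ 0ℓ
ℚ-ring = fromCommutativeRing +-*-commutativeRing (λ x → dec⇒maybe (0ℚ ≟ x))

≡-modulo : ∀ {x y} e c → e ≡ 0ℚ → x ≡ y + e * c → x ≡ y
≡-modulo {y = y} e c refl x≡ = trans x≡ (trans (cong (λ z → y + z) (*-zeroˡ c)) (+-identityʳ y))

*-pos : ∀ {a b} → 0ℚ < a → 0ℚ < b → 0ℚ < a * b
*-pos {a} {b} a>0 b>0 = positive⁻¹ _ {{pos*pos⇒pos a {{positive a>0}} b {{positive b>0}}}}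

*-nonNeg : ∀ {a b} → 0ℚ ≤ a → 0ℚ ≤ b → 0ℚ ≤ a * b
*-nonNeg {a} {b} a≥0 b≥0 = nonNegative⁻¹ _ {{nonNeg*nonNeg⇒nonNeg a {{nonNegative a≥0}} b {{nonNegative b≥0}}}}

*-cancelʳ-pos : ∀ {a c} → 0ℚ < c → 0ℚ < a * c → 0ℚ < a
*-cancelʳ-pos {a} {c} c>0 ac>0 = *-cancelʳ-<-nonNeg c {{nonNegative (<⇒≤ c>0)}} (subst (_< a * c) (sym (*-zeroˡ c)) ac>0)

*-cancelʳ-nonNeg : ∀ {a c} → 0ℚ < c → 0ℚ ≤ a * c → 0ℚ ≤ a
*-cancelʳ-nonNeg {a} {c} c>0 ac≥0 = *-cancelʳ-≤-pos c {{positive c>0}} (subst (_≤ a * c) (sym (*-zeroˡ c)) ac≥0)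

*-cancelˡ-pos : ∀ {a c} → 0ℚ < c → 0ℚ < c * a → 0ℚ < a
*-cancelˡ-pos {a} {c} c>0 ca>0 = *-cancelʳ-pos c>0 (subst (0ℚ <_) (*-comm c a) ca>0)

difference-zero⇒≡ : ∀ {x y} → x - y ≡ 0ℚ → x ≡ y
difference-zero⇒≡ {x} {y} x-y≡0 = ≡-modulo (x - y) 1ℚ x-y≡0 (lemma x y)
  where
  lemma : ∀ x y → x ≡ y + (x - y) * 1ℚ
  lemma = solve-∀ ℚ-ring

≡⇒difference-zero : ∀ {x y} → x ≡ y → x - y ≡ 0ℚ
≡⇒difference-zero {y = y} refl = +-inverseʳ y

0<1 : 0ℚ < 1ℚ
0<1 = positive⁻¹ 1ℚ

square-pos : ∀ {x} → x ≢ 0ℚ → 0ℚ < x * x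
square-pos {x} x≢0 with <-cmp 0ℚ x
... | tri< x>0 _ _ = *-pos x>0 x>0
... | tri≈ _ 0≡x _ = ⊥-elim (x≢0 (sym 0≡x))
... | tri> _ _ x<0 = subst (0ℚ <_) (neg-square x) (*-pos (neg-antimono-< x<0) (neg-antimono-< x<0))
  where
  neg-square : ∀ x → (- x) * (- x) ≡ x * x
  neg-square = solve-∀ ℚ-ring

square-nonneg : ∀ x → 0ℚ ≤ x * x
square-nonneg x with x ≟ 0ℚ
... | yes refl = ≤-reflexive (sym (*-zeroˡ 0ℚ))
... | no x≢0 = <⇒≤ (square-pos x≢0)

weighted-sum-mono : ∀ {w₀ w₁ w₂ a b c a′ b′ c′} → 0ℚ ≤ w₀ → 0ℚ ≤ w₁ → 0ℚ ≤ w₂ → a ≤ a′ → b ≤ b′ → c ≤ c′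
  → w₀ * a + w₁ * b + w₂ * c ≤ w₀ * a′ + w₁ * b′ + w₂ * c′
weighted-sum-mono w₀≥0 w₁≥0 w₂≥0 a≤a′ b≤b′ c≤c′ =
  +-mono-≤ (+-mono-≤ (scale w₀≥0 a≤a′) (scale w₁≥0 b≤b′)) (scale w₂≥0 c≤c′)
  where
  scale : ∀ {w a b} → 0ℚ ≤ w → a ≤ b → w * a ≤ w * b
  scale {w} w≥0 = *-monoˡ-≤-nonNeg w {{nonNegative w≥0}}

weighted-sum-constant : ∀ w₀ w₁ w₂ m → w₀ + w₁ + w₂ ≡ 1ℚ → w₀ * m + w₁ * m + w₂ * m ≡ m
weighted-sum-constant w₀ w₁ w₂ m sum≡1 = begin
  w₀ * m + w₁ * m + w₂ * m    ≡⟨ factor w₀ w₁ w₂ m ⟩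
  (w₀ + w₁ + w₂) * m          ≡⟨ cong (_* m) sum≡1 ⟩
  1ℚ * m                      ≡⟨ *-identityˡ m ⟩
  m                           ∎
  where
  open ≡-Reasoning
  factor : ∀ a b c m → a * m + b * m + c * m ≡ (a + b + c) * m
  factor = solve-∀ ℚ-ring

pos-inverse : ∀ {a} → 0ℚ < a → ∃[ w ] (a * w ≡ 1ℚ × 0ℚ < w)
pos-inverse {a} a>0 = (1/ a) {{nz}} , *-inverseʳ a {{nz}} , positive⁻¹ _ {{1/pos⇒pos a {{positive a>0}}}}
  where
  nz : NonZero a
  nz = pos⇒nonZero a {{positive a>0}}

infixr 25 _∙_
infix 4 _∝_

_∙_ : ℚ → Pt → Pt
r ∙ x = pt (r * px x) (r * py x)

origin : Pt
origin = pt 0ℚ 0ℚ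

⟦_⟧ : Vec2 → Pt
⟦ v ⟧ = pt (toℚ (vx v)) (toℚ (vy v))

det : Pt → Pt → ℚ
det x y = px x * py y - py x * px y

-- φ u = shear ⟦ u ⟧, and r · v = r ∙ ⟦ v ⟧, definitionally.
shear : Pt → Pt → Pt
shear k z = z ⊕ (det k z ∙ k)

record _∝_ (x y : Pt) : Set where
  constructor multiple
  field
    ratio : ℚ
    ratio>0 : 0ℚ < ratio
    is-multiple : x ≡ ratio ∙ y

pt-≡ : ∀ {x y} → px x ≡ px y → py x ≡ py y → x ≡ y
pt-≡ {pt _ _} {pt _ _} refl refl = refl

≡-moduloᵖ : ∀ {x y} e v → e ≡ 0ℚ → x ≡ y ⊕ e ∙ v → x ≡ y
≡-moduloᵖ e v e≡0 x≡ = pt-≡ (≡-modulo e (px v) e≡0 (cong px x≡)) (≡-modulo e (py v) e≡0 (cong py x≡))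

⊕-⊖-cancel : ∀ p x → (p ⊕ x) ⊖ p ≡ x
⊕-⊖-cancel (pt p₁ p₂) (pt x₁ x₂) = pt-≡ (coordinate p₁ x₁) (coordinate p₂ x₂)
  where
  coordinate : ∀ p x → p + x - p ≡ x
  coordinate = solve-∀ ℚ-ring

⊖-⊕-cancel : ∀ p y → p ⊕ (y ⊖ p) ≡ y
⊖-⊕-cancel (pt p₁ p₂) (pt y₁ y₂) = pt-≡ (coordinate p₁ y₁) (coordinate p₂ y₂)
  where
  coordinate : ∀ p y → p + (y - p) ≡ y
  coordinate = solve-∀ ℚ-ring

⊖-self : ∀ p → p ⊖ p ≡ origin
⊖-self (pt p₁ p₂) = pt-≡ (+-inverseʳ p₁) (+-inverseʳ p₂)

∙-assoc : ∀ r s x → r ∙ s ∙ x ≡ (r * s) ∙ x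
∙-assoc r s (pt x₁ x₂) = pt-≡ (sym (*-assoc r s x₁)) (sym (*-assoc r s x₂))

∙-identity : ∀ x → 1ℚ ∙ x ≡ x
∙-identity (pt x₁ x₂) = pt-≡ (*-identityˡ x₁) (*-identityˡ x₂)

shear-⊕ : ∀ k x y → shear k (x ⊕ y) ≡ shear k x ⊕ shear k y
shear-⊕ (pt k₁ k₂) (pt x₁ x₂) (pt y₁ y₂) = pt-≡ (coordinate k₁ x₁ y₁) (coordinate k₂ x₂ y₂)
  where
  coordinate : ∀ kᵢ xᵢ yᵢ → xᵢ + yᵢ + (k₁ * (x₂ + y₂) - k₂ * (x₁ + y₁)) * kᵢ
                            ≡ xᵢ + (k₁ * x₂ - k₂ * x₁) * kᵢ + (yᵢ + (k₁ * y₂ - k₂ * y₁) * kᵢ)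
  coordinate kᵢ xᵢ yᵢ = solve (kᵢ ∷ xᵢ ∷ yᵢ ∷ k₁ ∷ k₂ ∷ x₁ ∷ x₂ ∷ y₁ ∷ y₂ ∷ []) ℚ-ring

shear-∙ : ∀ k r x → shear k (r ∙ x) ≡ r ∙ shear k x
shear-∙ (pt k₁ k₂) r (pt x₁ x₂) = pt-≡ (coordinate k₁ x₁) (coordinate k₂ x₂)
  where
  coordinate : ∀ kᵢ xᵢ → r * xᵢ + (k₁ * (r * x₂) - k₂ * (r * x₁)) * kᵢ ≡ r * (xᵢ + (k₁ * x₂ - k₂ * x₁) * kᵢ)
  coordinate kᵢ xᵢ = solve (kᵢ ∷ xᵢ ∷ k₁ ∷ k₂ ∷ r ∷ x₁ ∷ x₂ ∷ []) ℚ-ring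

det-shear : ∀ k z → det (shear k z) k ≡ det z k
det-shear (pt k₁ k₂) (pt z₁ z₂) = lemma k₁ k₂ z₁ z₂
  where
  lemma : ∀ k₁ k₂ z₁ z₂ → let d = k₁ * z₂ - k₂ * z₁ in (z₁ + d * k₁) * k₂ - (z₂ + d * k₂) * k₁ ≡ z₁ * k₂ - z₂ * k₁
  lemma = solve-∀ ℚ-ring

shear-fixes-axis : ∀ k z → det z k ≡ 0ℚ → shear k z ≡ z
shear-fixes-axis k@(pt k₁ k₂) z@(pt z₁ z₂) z∥k =
  ≡-moduloᵖ (det z k) ((- 1ℚ) ∙ k) z∥k (pt-≡ (coordinate k₁ z₁) (coordinate k₂ z₂))
  where
  coordinate : ∀ kᵢ zᵢ → zᵢ + (k₁ * z₂ - k₂ * z₁) * kᵢ ≡ zᵢ + (z₁ * k₂ - z₂ * k₁) * (- 1ℚ * kᵢ)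
  coordinate kᵢ zᵢ = solve (kᵢ ∷ zᵢ ∷ k₁ ∷ k₂ ∷ z₁ ∷ z₂ ∷ []) ℚ-ring

⊖-flip : ∀ P Q → P ⊖ Q ≡ (- 1ℚ) ∙ (Q ⊖ P)
⊖-flip (pt p₁ p₂) (pt q₁ q₂) = pt-≡ (coordinate p₁ q₁) (coordinate p₂ q₂)
  where
  coordinate : ∀ p q → p - q ≡ - 1ℚ * (q - p)
  coordinate = solve-∀ ℚ-ring

∙-comm : ∀ r s x → r ∙ s ∙ x ≡ s ∙ r ∙ x
∙-comm r s (pt x₁ x₂) = pt-≡ (coordinate x₁) (coordinate x₂)
  where
  coordinate : ∀ x → r * (s * x) ≡ s * (r * x)
  coordinate x = solve (r ∷ s ∷ x ∷ []) ℚ-ring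

det-self : ∀ x → det x x ≡ 0ℚ
det-self (pt x₁ x₂) = lemma x₁ x₂
  where
  lemma : ∀ x₁ x₂ → x₁ * x₂ - x₂ * x₁ ≡ 0ℚ
  lemma = solve-∀ ℚ-ring

det-origin : ∀ o n → det (o ⊖ o) n ≡ 0ℚ
det-origin (pt o₁ o₂) (pt n₁ n₂) = lemma o₁ o₂ n₁ n₂
  where
  lemma : ∀ o₁ o₂ n₁ n₂ → (o₁ - o₁) * n₂ - (o₂ - o₂) * n₁ ≡ 0ℚ
  lemma = solve-∀ ℚ-ring

det-antisym : ∀ x y → det x y ≡ - det y x
det-antisym (pt x₁ x₂) (pt y₁ y₂) = lemma x₁ x₂ y₁ y₂
  where
  lemma : ∀ x₁ x₂ y₁ y₂ → x₁ * y₂ - x₂ * y₁ ≡ - (y₁ * x₂ - y₂ * x₁)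
  lemma = solve-∀ ℚ-ring

det-∙ʳ : ∀ r x y → det x (r ∙ y) ≡ r * det x y
det-∙ʳ r (pt x₁ x₂) (pt y₁ y₂) = lemma r x₁ x₂ y₁ y₂
  where
  lemma : ∀ r x₁ x₂ y₁ y₂ → x₁ * (r * y₂) - x₂ * (r * y₁) ≡ r * (x₁ * y₂ - x₂ * y₁)
  lemma = solve-∀ ℚ-ring

det-∙ˡ : ∀ r x y → det (r ∙ x) y ≡ r * det x y
det-∙ˡ r (pt x₁ x₂) (pt y₁ y₂) = lemma r x₁ x₂ y₁ y₂
  where
  lemma : ∀ r x₁ x₂ y₁ y₂ → r * x₁ * y₂ - r * x₂ * y₁ ≡ r * (x₁ * y₂ - x₂ * y₁)
  lemma = solve-∀ ℚ-ring

det-opposite : ∀ P Q → det (P ⊖ Q) (Q ⊖ P) ≡ 0ℚ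
det-opposite (pt p₁ p₂) (pt q₁ q₂) = lemma p₁ p₂ q₁ q₂
  where
  lemma : ∀ p₁ p₂ q₁ q₂ → (p₁ - q₁) * (q₂ - p₂) - (p₂ - q₂) * (q₁ - p₁) ≡ 0ℚ
  lemma = solve-∀ ℚ-ring

∝-trans : ∀ {x y z} → x ∝ y → y ∝ z → x ∝ z
∝-trans {z = z} (multiple r r>0 refl) (multiple s s>0 refl) = multiple (r * s) (*-pos r>0 s>0) (∙-assoc r s z)

∝-shear : ∀ k {x y} → x ∝ y → shear k x ∝ shear k y
∝-shear k {y = y} (multiple r r>0 refl) = multiple r r>0 (shear-∙ k r y)

∝-by : ∀ {x y s c} → 0ℚ < s → 0ℚ < c → s ∙ x ≡ c ∙ y → x ∝ y
∝-by {x} {y} {s} {c} s>0 c>0 sx≡cy with pos-inverse s>0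
... | w , sw≡1 , w>0 = multiple (w * c) (*-pos w>0 c>0) (begin
  x               ≡⟨ sym (∙-identity x) ⟩
  1ℚ ∙ x          ≡⟨ cong (_∙ x) (trans (sym sw≡1) (*-comm s w)) ⟩
  (w * s) ∙ x     ≡⟨ sym (∙-assoc w s x) ⟩
  w ∙ s ∙ x       ≡⟨ cong (w ∙_) sx≡cy ⟩
  w ∙ c ∙ y       ≡⟨ ∙-assoc w c y ⟩
  (w * c) ∙ y     ∎)
  where open ≡-Reasoning

∙-origin : ∀ c → c ∙ origin ≡ origin
∙-origin c = pt-≡ (*-zeroʳ c) (*-zeroʳ c)

∙-cancel-origin : ∀ {r x} → 0ℚ < r → r ∙ x ≡ origin → x ≡ origin
∙-cancel-origin {r} {x} r>0 rx≡0 = multiple-of-origin (∝-by r>0 0<1 (trans rx≡0 (sym (∙-origin 1ℚ))))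
  where
  multiple-of-origin : x ∝ origin → x ≡ origin
  multiple-of-origin (multiple c _ x≡) = trans x≡ (∙-origin c)

norm² : Pt → ℚ
norm² x = px x * px x + py x * py x

dot : Pt → Pt → ℚ
dot x y = px x * px y + py x * py y

norm²-decomposition : ∀ v w → norm² v ∙ w ≡ dot v w ∙ v ⊕ det v w ∙ pt (- py v) (px v)
norm²-decomposition (pt v₁ v₂) (pt w₁ w₂) = pt-≡ x-coordinate y-coordinate
  where
  x-coordinate : (v₁ * v₁ + v₂ * v₂) * w₁ ≡ (v₁ * w₁ + v₂ * w₂) * v₁ + (v₁ * w₂ - v₂ * w₁) * (- v₂)
  x-coordinate = solve (v₁ ∷ v₂ ∷ w₁ ∷ w₂ ∷ []) ℚ-ring
  y-coordinate : (v₁ * v₁ + v₂ * v₂) * w₂ ≡ (v₁ * w₁ + v₂ * w₂) * v₂ + (v₁ * w₂ - v₂ * w₁) * v₁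
  y-coordinate = solve (v₁ ∷ v₂ ∷ w₁ ∷ w₂ ∷ []) ℚ-ring

∝-reverse : ∀ P Q R S → P ⊖ Q ∝ R ⊖ S → Q ⊖ P ∝ S ⊖ R
∝-reverse P Q R S (multiple r r>0 P-Q≡) = multiple r r>0 (begin
  Q ⊖ P                  ≡⟨ ⊖-flip Q P ⟩
  (- 1ℚ) ∙ (P ⊖ Q)       ≡⟨ cong ((- 1ℚ) ∙_) P-Q≡ ⟩
  (- 1ℚ) ∙ r ∙ (R ⊖ S)   ≡⟨ ∙-comm (- 1ℚ) r (R ⊖ S) ⟩
  r ∙ (- 1ℚ) ∙ (R ⊖ S)   ≡⟨ cong (r ∙_) (⊖-flip S R) ⟨
  r ∙ (S ⊖ R)            ∎)
  where open ≡-Reasoning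

∝-reverse-shear : ∀ k P Q R S → P ⊖ Q ∝ shear k (R ⊖ S) → Q ⊖ P ∝ shear k (S ⊖ R)
∝-reverse-shear k P Q R S (multiple r r>0 P-Q≡) = multiple r r>0 (begin
  Q ⊖ P                            ≡⟨ ⊖-flip Q P ⟩
  (- 1ℚ) ∙ (P ⊖ Q)                 ≡⟨ cong ((- 1ℚ) ∙_) P-Q≡ ⟩
  (- 1ℚ) ∙ r ∙ shear k (R ⊖ S)     ≡⟨ ∙-comm (- 1ℚ) r (shear k (R ⊖ S)) ⟩
  r ∙ (- 1ℚ) ∙ shear k (R ⊖ S)     ≡⟨ cong (r ∙_) (shear-∙ k (- 1ℚ) (R ⊖ S)) ⟨
  r ∙ shear k ((- 1ℚ) ∙ (R ⊖ S))   ≡⟨ cong (λ x → r ∙ shear k x) (⊖-flip S R) ⟨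
  r ∙ shear k (S ⊖ R)              ∎)
  where open ≡-Reasoning

-- Read β ∙ (P ⊖ M) ≡ α ∙ (M ⊖ Q) with α, β > 0 as: M lies on the segment PQ.
between-ratio : ∀ α β P M Q → β ∙ (P ⊖ M) ≡ α ∙ (M ⊖ Q) → β ∙ (P ⊖ Q) ≡ (α + β) ∙ (M ⊖ Q)
between-ratio α β P M Q PM≡MQ = begin
  β ∙ (P ⊖ Q)                    ≡⟨ split P M Q ⟩
  β ∙ (P ⊖ M) ⊕ β ∙ (M ⊖ Q)      ≡⟨ cong (_⊕ β ∙ (M ⊖ Q)) PM≡MQ ⟩
  α ∙ (M ⊖ Q) ⊕ β ∙ (M ⊖ Q)      ≡⟨ collect (M ⊖ Q) ⟩
  (α + β) ∙ (M ⊖ Q)              ∎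
  where
  open ≡-Reasoning
  split : ∀ P M Q → β ∙ (P ⊖ Q) ≡ β ∙ (P ⊖ M) ⊕ β ∙ (M ⊖ Q)
  split (pt p₁ p₂) (pt m₁ m₂) (pt q₁ q₂) = pt-≡ (coordinate p₁ m₁ q₁) (coordinate p₂ m₂ q₂)
    where
    coordinate : ∀ p m q → β * (p - q) ≡ β * (p - m) + β * (m - q)
    coordinate p m q = solve (β ∷ p ∷ m ∷ q ∷ []) ℚ-ring
  collect : ∀ x → α ∙ x ⊕ β ∙ x ≡ (α + β) ∙ x
  collect (pt x₁ x₂) = pt-≡ (sym (*-distribʳ-+ x₁ α β)) (sym (*-distribʳ-+ x₂ α β))

between-reverse : ∀ α β P M Q → β ∙ (P ⊖ M) ≡ α ∙ (M ⊖ Q) → α ∙ (Q ⊖ M) ≡ β ∙ (M ⊖ P)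
between-reverse α β P M Q PM≡MQ = begin
  α ∙ (Q ⊖ M)                ≡⟨ cong (α ∙_) (⊖-flip Q M) ⟩
  α ∙ (- 1ℚ) ∙ (M ⊖ Q)       ≡⟨ ∙-comm α (- 1ℚ) (M ⊖ Q) ⟩
  (- 1ℚ) ∙ α ∙ (M ⊖ Q)       ≡⟨ cong ((- 1ℚ) ∙_) PM≡MQ ⟨
  (- 1ℚ) ∙ β ∙ (P ⊖ M)       ≡⟨ ∙-comm (- 1ℚ) β (P ⊖ M) ⟩
  β ∙ (- 1ℚ) ∙ (P ⊖ M)       ≡⟨ cong (β ∙_) (⊖-flip M P) ⟨
  β ∙ (M ⊖ P)                ∎
  where open ≡-Reasoning

toℚᵘ-toℚ : ∀ z → toℚᵘ (toℚ z) ℚᵘ.≃ ℚᵘ.mkℚᵘ z 0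
toℚᵘ-toℚ z = toℚᵘ-fromℚᵘ (ℚᵘ.mkℚᵘ z 0)

toℚ-injective : ∀ {x y} → toℚ x ≡ toℚ y → x ≡ y
toℚ-injective {x} {y} eq with ℚᵘ.≃-trans (ℚᵘ.≃-sym (toℚᵘ-toℚ x)) (ℚᵘ.≃-trans (toℚᵘ-cong eq) (toℚᵘ-toℚ y))
... | ℚᵘ.*≡* x*1≡y*1 = trans (sym (ℤ.*-identityʳ x)) (trans x*1≡y*1 (ℤ.*-identityʳ y))

toℚ-homo-+ : ∀ x y → toℚ (x ℤ.+ y) ≡ toℚ x + toℚ y
toℚ-homo-+ x y = toℚᵘ-injective (begin
  toℚᵘ (toℚ (x ℤ.+ y))                   ≈⟨ toℚᵘ-toℚ (x ℤ.+ y) ⟩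
  ℚᵘ.mkℚᵘ (x ℤ.+ y) 0                     ≈⟨ ℚᵘ.*≡* (lemma x y) ⟩
  ℚᵘ.mkℚᵘ x 0 ℚᵘ.+ ℚᵘ.mkℚᵘ y 0            ≈⟨ ℚᵘ.+-cong (toℚᵘ-toℚ x) (toℚᵘ-toℚ y) ⟨
  toℚᵘ (toℚ x) ℚᵘ.+ toℚᵘ (toℚ y)          ≈⟨ toℚᵘ-homo-+ (toℚ x) (toℚ y) ⟨
  toℚᵘ (toℚ x + toℚ y)                   ∎)
  where
  open ℚᵘ.≃-Reasoning
  lemma : ∀ x y → (x ℤ.+ y) ℤ.* + 1 ≡ (x ℤ.* + 1 ℤ.+ y ℤ.* + 1) ℤ.* + 1
  lemma = ℤ-Solver.solve-∀

toℚ-homo-* : ∀ x y → toℚ (x ℤ.* y) ≡ toℚ x * toℚ y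
toℚ-homo-* x y = toℚᵘ-injective (begin
  toℚᵘ (toℚ (x ℤ.* y))                   ≈⟨ toℚᵘ-toℚ (x ℤ.* y) ⟩
  ℚᵘ.mkℚᵘ x 0 ℚᵘ.* ℚᵘ.mkℚᵘ y 0            ≈⟨ ℚᵘ.*-cong (toℚᵘ-toℚ x) (toℚᵘ-toℚ y) ⟨
  toℚᵘ (toℚ x) ℚᵘ.* toℚᵘ (toℚ y)          ≈⟨ toℚᵘ-homo-* (toℚ x) (toℚ y) ⟨
  toℚᵘ (toℚ x * toℚ y)                   ∎)
  where open ℚᵘ.≃-Reasoning

toℚ-homo-neg : ∀ x → toℚ (ℤ.- x) ≡ - toℚ x
toℚ-homo-neg x = toℚᵘ-injective (begin
  toℚᵘ (toℚ (ℤ.- x))   ≈⟨ toℚᵘ-toℚ (ℤ.- x) ⟩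
  ℚᵘ.- ℚᵘ.mkℚᵘ x 0     ≈⟨ ℚᵘ.-‿cong (toℚᵘ-toℚ x) ⟨
  ℚᵘ.- toℚᵘ (toℚ x)    ≈⟨ toℚᵘ-homo‿- (toℚ x) ⟨
  toℚᵘ (- toℚ x)       ∎)
  where open ℚᵘ.≃-Reasoning

toℚ-numerator : ∀ r → r * toℚ (↧ r) ≡ toℚ (↥ r)
toℚ-numerator r@(mkℚ n d _) = toℚᵘ-injective (begin
  toℚᵘ (r * toℚ (+ suc d))              ≈⟨ toℚᵘ-homo-* r (toℚ (+ suc d)) ⟩
  toℚᵘ r ℚᵘ.* toℚᵘ (toℚ (+ suc d))      ≈⟨ ℚᵘ.*-congˡ {toℚᵘ r} (toℚᵘ-toℚ (+ suc d)) ⟩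
  ℚᵘ.mkℚᵘ n d ℚᵘ.* ℚᵘ.mkℚᵘ (+ suc d) 0  ≈⟨ ℚᵘ.*≡* (lemma n d) ⟩
  ℚᵘ.mkℚᵘ n 0                           ≈⟨ toℚᵘ-toℚ n ⟨
  toℚᵘ (toℚ n)                          ∎)
  where
  open ℚᵘ.≃-Reasoning
  lemma : ∀ n d → (n ℤ.* + suc d) ℤ.* + 1 ≡ n ℤ.* + (suc d ℕ.* 1)
  lemma n d = trans (ℤ.*-identityʳ _) (cong (λ m → n ℤ.* + m) (sym (ℕ.*-identityʳ (suc d))))

neg : Vec2 → Vec2
neg v = vec (ℤ.- vx v) (ℤ.- vy v)

φℤ : Vec2 → Vec2 → Vec2
φℤ u v = vec (vx v ℤ.+ detℤ u v ℤ.* vx u) (vy v ℤ.+ detℤ u v ℤ.* vy u)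

neg-as-scaling : ∀ x → - x ≡ (- 1ℚ) * x
neg-as-scaling = solve-∀ ℚ-ring

toℚ-detℤ : ∀ v w → toℚ (detℤ v w) ≡ det ⟦ v ⟧ ⟦ w ⟧
toℚ-detℤ v w = begin
  toℚ (vx v ℤ.* vy w ℤ.+ ℤ.- (vy v ℤ.* vx w))       ≡⟨ toℚ-homo-+ (vx v ℤ.* vy w) _ ⟩
  toℚ (vx v ℤ.* vy w) + toℚ (ℤ.- (vy v ℤ.* vx w))  ≡⟨ cong₂ _+_ (toℚ-homo-* (vx v) (vy w)) (toℚ-homo-neg (vy v ℤ.* vx w)) ⟩
  toℚ (vx v) * toℚ (vy w) - toℚ (vy v ℤ.* vx w)    ≡⟨ cong (λ z → toℚ (vx v) * toℚ (vy w) - z) (toℚ-homo-* (vy v) (vx w)) ⟩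
  det ⟦ v ⟧ ⟦ w ⟧                                   ∎
  where open ≡-Reasoning

⟦⟧-+v : ∀ v w → ⟦ v +v w ⟧ ≡ ⟦ v ⟧ ⊕ ⟦ w ⟧
⟦⟧-+v v w = cong₂ pt (toℚ-homo-+ (vx v) (vx w)) (toℚ-homo-+ (vy v) (vy w))

⟦⟧-neg : ∀ v → ⟦ neg v ⟧ ≡ (- 1ℚ) ∙ ⟦ v ⟧
⟦⟧-neg v = cong₂ pt (trans (toℚ-homo-neg (vx v)) (neg-as-scaling _)) (trans (toℚ-homo-neg (vy v)) (neg-as-scaling _))

⟦⟧-φℤ : ∀ u v → ⟦ φℤ u v ⟧ ≡ φ u ⟦ v ⟧
⟦⟧-φℤ u v = cong₂ pt (coordinate (vx v) (vx u)) (coordinate (vy v) (vy u))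
  where
  coordinate : ∀ x y → toℚ (x ℤ.+ detℤ u v ℤ.* y) ≡ toℚ x + det ⟦ u ⟧ ⟦ v ⟧ * toℚ y
  coordinate x y = trans (toℚ-homo-+ x _) (cong (λ z → toℚ x + z) (trans (toℚ-homo-* (detℤ u v) y) (cong (_* toℚ y) (toℚ-detℤ u v))))

Primitive-neg : ∀ {v} → Primitive v → Primitive (neg v)
Primitive-neg {vec x y} = trans (cong₂ gcd (ℤ.∣-i∣≡∣i∣ x) (ℤ.∣-i∣≡∣i∣ y))

-- A common divisor of the coordinates of φℤ u v divides those of v = φℤ u v - detℤ u (φℤ u v) u.
Primitive-φℤ : ∀ u {v} → Primitive v → Primitive (φℤ u v)
Primitive-φℤ u {v} pv =
  ℕ.∣1⇒≡1 (subst (g ℕ.∣_) pv (gcd-greatest (g∣ (vx v) (vx u) g∣w₁ unshear₁) (g∣ (vy v) (vy u) g∣w₂ unshear₂)))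
  where
  w : Vec2
  w = φℤ u v
  g : ℕ
  g = gcd ℤ.∣ vx w ∣ ℤ.∣ vy w ∣
  g∣w₁ : + g ℤ.∣ vx w
  g∣w₁ = ℤ.∣ᵤ⇒∣ (gcd[m,n]∣m ℤ.∣ vx w ∣ ℤ.∣ vy w ∣)
  g∣w₂ : + g ℤ.∣ vy w
  g∣w₂ = ℤ.∣ᵤ⇒∣ (gcd[m,n]∣n ℤ.∣ vx w ∣ ℤ.∣ vy w ∣)
  g∣det : + g ℤ.∣ detℤ u w
  g∣det = ℤ.∣m∣n⇒∣m-n (ℤ.∣n⇒∣m*n (vx u) g∣w₂) (ℤ.∣n⇒∣m*n (vy u) g∣w₁)
  g∣ : ∀ z y {x} → + g ℤ.∣ x → x ℤ.- detℤ u w ℤ.* y ≡ z → g ℕ.∣ ℤ.∣ z ∣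
  g∣ z y g∣x eq = ℤ.∣⇒∣ᵤ (subst (+ g ℤ.∣_) eq (ℤ.∣m∣n⇒∣m-n g∣x (ℤ.∣m⇒∣m*n y g∣det)))
  unshear₁ : vx w ℤ.- detℤ u w ℤ.* vx u ≡ vx v
  unshear₁ = lemma (vx u) (vy u) (vx v) (vy v)
    where
    lemma : ∀ a b x y → let d = a ℤ.* y ℤ.- b ℤ.* x; x′ = x ℤ.+ d ℤ.* a; y′ = y ℤ.+ d ℤ.* b in
      x′ ℤ.- (a ℤ.* y′ ℤ.- b ℤ.* x′) ℤ.* a ≡ x
    lemma = ℤ-Solver.solve-∀
  unshear₂ : vy w ℤ.- detℤ u w ℤ.* vy u ≡ vy v
  unshear₂ = lemma (vx u) (vy u) (vx v) (vy v)
    where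
    lemma : ∀ a b x y → let d = a ℤ.* y ℤ.- b ℤ.* x; x′ = x ℤ.+ d ℤ.* a; y′ = y ℤ.+ d ℤ.* b in
      y′ ℤ.- (a ℤ.* y′ ℤ.- b ℤ.* x′) ℤ.* b ≡ y
    lemma = ℤ-Solver.solve-∀

Primitive-nonzero : ∀ {v} → Primitive v → ⟦ v ⟧ ≢ origin
Primitive-nonzero {vec x y} pv eq with toℚ-injective {x} {+ 0} (cong px eq) | toℚ-injective {y} {+ 0} (cong py eq)
... | refl | refl with trans (sym gcd[0,0]≡0) pv
... | ()

scaled-primitive-unique : ∀ {v w} n m → Primitive v → Primitive w
  → +[1+ n ] ℤ.* vx v ≡ +[1+ m ] ℤ.* vx w → +[1+ n ] ℤ.* vy v ≡ +[1+ m ] ℤ.* vy w → v ≡ w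
scaled-primitive-unique {vec a b} {vec c d} n m pv pw nv₁≡mw₁ nv₂≡mw₂ =
  cong₂ vec (ℤ.*-cancelˡ-≡ +[1+ n ] a c (trans nv₁≡mw₁ (cong (ℤ._* c) (sym n≡m))))
            (ℤ.*-cancelˡ-≡ +[1+ n ] b d (trans nv₂≡mw₂ (cong (ℤ._* d) (sym n≡m))))
  where
  gcd-scaled : ∀ k x y → gcd ℤ.∣ + k ℤ.* x ∣ ℤ.∣ + k ℤ.* y ∣ ≡ k ℕ.* gcd ℤ.∣ x ∣ ℤ.∣ y ∣
  gcd-scaled k x y = trans (cong₂ gcd (ℤ.abs-* (+ k) x) (ℤ.abs-* (+ k) y)) (sym (c*gcd[m,n]≡gcd[cm,cn] k _ _))
  n≡m : +[1+ n ] ≡ +[1+ m ]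
  n≡m = cong +_ (begin
    suc n                                          ≡⟨ ℕ.*-identityʳ (suc n) ⟨
    suc n ℕ.* 1                                    ≡⟨ cong (suc n ℕ.*_) pv ⟨
    suc n ℕ.* gcd ℤ.∣ a ∣ ℤ.∣ b ∣                  ≡⟨ gcd-scaled (suc n) a b ⟨
    gcd ℤ.∣ +[1+ n ] ℤ.* a ∣ ℤ.∣ +[1+ n ] ℤ.* b ∣   ≡⟨ cong₂ (λ p q → gcd ℤ.∣ p ∣ ℤ.∣ q ∣) nv₁≡mw₁ nv₂≡mw₂ ⟩
    gcd ℤ.∣ +[1+ m ] ℤ.* c ∣ ℤ.∣ +[1+ m ] ℤ.* d ∣   ≡⟨ gcd-scaled (suc m) c d ⟩
    suc m ℕ.* gcd ℤ.∣ c ∣ ℤ.∣ d ∣                  ≡⟨ cong (suc m ℕ.*_) pw ⟩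
    suc m ℕ.* 1                                    ≡⟨ ℕ.*-identityʳ (suc m) ⟩
    suc m                                          ∎)
    where open ≡-Reasoning

positive-cross-numerator : ∀ {r} s → 0ℚ < r → ∃[ k ] (↥ r ℤ.* ↧ s ≡ +[1+ k ])
positive-cross-numerator {r} s r>0 = cross r {{positive r>0}}
  where
  cross : ∀ r → .{{ℚ.Positive r}} → ∃[ k ] (↥ r ℤ.* ↧ s ≡ +[1+ k ])
  cross (mkℚ +[1+ n ] _ _) = _ , refl

clear-denominators : ∀ r s a c → r * toℚ a ≡ s * toℚ c → (↥ r ℤ.* ↧ s) ℤ.* a ≡ (↥ s ℤ.* ↧ r) ℤ.* c
clear-denominators r s a c eq = toℚ-injective (begin
  toℚ ((↥ r ℤ.* ↧ s) ℤ.* a)                      ≡⟨ toℚ-homo-*₃ (↥ r) (↧ s) a ⟩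
  toℚ (↥ r) * toℚ (↧ s) * toℚ a                  ≡⟨ cong (λ z → z * toℚ (↧ s) * toℚ a) (toℚ-numerator r) ⟨
  r * toℚ (↧ r) * toℚ (↧ s) * toℚ a              ≡⟨ regroup r (toℚ (↧ r)) (toℚ (↧ s)) (toℚ a) ⟩
  (r * toℚ a) * (toℚ (↧ r) * toℚ (↧ s))          ≡⟨ cong (_* (toℚ (↧ r) * toℚ (↧ s))) eq ⟩
  (s * toℚ c) * (toℚ (↧ r) * toℚ (↧ s))          ≡⟨ cong ((s * toℚ c) *_) (*-comm (toℚ (↧ r)) (toℚ (↧ s))) ⟩
  (s * toℚ c) * (toℚ (↧ s) * toℚ (↧ r))          ≡⟨ regroup s (toℚ (↧ s)) (toℚ (↧ r)) (toℚ c) ⟨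
  s * toℚ (↧ s) * toℚ (↧ r) * toℚ c              ≡⟨ cong (λ z → z * toℚ (↧ r) * toℚ c) (toℚ-numerator s) ⟩
  toℚ (↥ s) * toℚ (↧ r) * toℚ c                  ≡⟨ toℚ-homo-*₃ (↥ s) (↧ r) c ⟨
  toℚ ((↥ s ℤ.* ↧ r) ℤ.* c)                      ∎)
  where
  open ≡-Reasoning
  toℚ-homo-*₃ : ∀ x y z → toℚ ((x ℤ.* y) ℤ.* z) ≡ toℚ x * toℚ y * toℚ z
  toℚ-homo-*₃ x y z = trans (toℚ-homo-* (x ℤ.* y) z) (cong (_* toℚ z) (toℚ-homo-* x y))
  regroup : ∀ x y z w → x * y * z * w ≡ (x * w) * (y * z)
  regroup = solve-∀ ℚ-ring
Primitive-unique : ∀ {v w r s} → Primitive v → Primitive w → 0ℚ < r → 0ℚ < s → r ∙ ⟦ v ⟧ ≡ s ∙ ⟦ w ⟧ → v ≡ w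
Primitive-unique {v} {w} {r} {s} pv pw r>0 s>0 eq with positive-cross-numerator s r>0 | positive-cross-numerator r s>0
... | n , N≡ | m , M≡ = scaled-primitive-unique n m pv pw (cleared (vx v) (vx w) (cong px eq)) (cleared (vy v) (vy w) (cong py eq))
  where
  cleared : ∀ a c → r * toℚ a ≡ s * toℚ c → +[1+ n ] ℤ.* a ≡ +[1+ m ] ℤ.* c
  cleared a c rs≡ = subst₂ (λ x y → x ℤ.* a ≡ y ℤ.* c) N≡ M≡ (clear-denominators r s a c rs≡)

norm²-pos : ∀ {v} → Primitive v → 0ℚ < norm² ⟦ v ⟧
norm²-pos {v} pv with toℚ (vx v) ≟ 0ℚ | toℚ (vy v) ≟ 0ℚ
... | _ | no y≢0 = +-mono-≤-< (square-nonneg (toℚ (vx v))) (square-pos y≢0)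
... | no x≢0 | _ = +-mono-<-≤ (square-pos x≢0) (square-nonneg (toℚ (vy v)))
... | yes x≡0 | yes y≡0 = ⊥-elim (Primitive-nonzero {v} pv (cong₂ pt x≡0 y≡0))

Primitive-parallel : ∀ {v w} → Primitive v → Primitive w → det ⟦ v ⟧ ⟦ w ⟧ ≡ 0ℚ → w ≡ v ⊎ w ≡ neg v
Primitive-parallel {v} {w} pv pw v∥w = by-sign (<-cmp 0ℚ (dot ⟦ v ⟧ ⟦ w ⟧))
  where
  V W : Pt
  V = ⟦ v ⟧
  W = ⟦ w ⟧
  projection : norm² V ∙ W ≡ dot V W ∙ V
  projection = ≡-moduloᵖ (det V W) (pt (- py V) (px V)) v∥w (norm²-decomposition V W)
  flip-sign : ∀ s x → s ∙ x ≡ (- s) ∙ (- 1ℚ) ∙ x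
  flip-sign s (pt x₁ x₂) = pt-≡ (coordinate s x₁) (coordinate s x₂)
    where
    coordinate : ∀ s x → s * x ≡ - s * (- 1ℚ * x)
    coordinate = solve-∀ ℚ-ring
  by-sign : Trichotomy (0ℚ < dot V W) (0ℚ ≡ dot V W) (dot V W < 0ℚ) → w ≡ v ⊎ w ≡ neg v
  by-sign (tri< s>0 _ _) = inj₁ (Primitive-unique {w} {v} pw pv (norm²-pos {v} pv) s>0 projection)
  by-sign (tri> _ _ s<0) = inj₂ (Primitive-unique {w} {neg v} pw (Primitive-neg {v} pv) (norm²-pos {v} pv) (neg-antimono-< s<0)
    (trans projection (trans (flip-sign (dot V W) V) (cong ((- dot V W) ∙_) (sym (⟦⟧-neg v))))))
  by-sign (tri≈ _ 0≡s _) = ⊥-elim (Primitive-nonzero {w} pw (∙-cancel-origin (norm²-pos {v} pv)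
    (trans projection (trans (cong (_∙ V) (sym 0≡s)) (zero-scaling V)))))
    where
    zero-scaling : ∀ x → 0ℚ ∙ x ≡ origin
    zero-scaling (pt x₁ x₂) = pt-≡ (*-zeroˡ x₁) (*-zeroˡ x₂)

-- Directions and integral bisectors

record Direction (P Q : Pt) (v : Vec2) : Set where
  constructor direction
  field
    is-primitive : Primitive v
    along : Q ⊖ P ∝ ⟦ v ⟧

record Bisector (Q R S : Pt) (u : Vec2) : Set where
  constructor bisector
  field
    {v w} : Vec2
    toR : Direction Q R v
    toS : Direction Q S w
    is-primitive : Primitive u
    sum : ⟦ v ⟧ ⊕ ⟦ w ⟧ ∝ ⟦ u ⟧

OnBisectorAt : Pt → Pt → Pt → Pt → Set
OnBisectorAt Q R S x = ∃[ u ] (Bisector Q R S u × ∃[ t ] (x ≡ Q ⊕ (t · u)))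

IsBarycentreOf : Pt → Pt → Pt → Pt → Set
IsBarycentreOf P Q R c = OnBisectorAt P Q R c × OnBisectorAt Q R P c × OnBisectorAt R P Q c

Direction-unique : ∀ {P Q v w} → Direction P Q v → Direction P Q w → v ≡ w
Direction-unique {v = v} {w} (direction pv (multiple r r>0 Q-P≡)) (direction pw (multiple s s>0 Q-P≡′)) =
  Primitive-unique {v} {w} pv pw r>0 s>0 (trans (sym Q-P≡) Q-P≡′)

Direction-irreflexive : ∀ {P v} → ¬ Direction P P v
Direction-irreflexive {P} {v} (direction pv (multiple r r>0 P-P≡)) =
  Primitive-nonzero {v} pv (∙-cancel-origin r>0 (trans (sym P-P≡) (⊖-self P)))

Direction-flip : ∀ {P Q v} → Direction P Q v → Direction Q P (neg v)
Direction-flip {P} {Q} {v} (direction pv (multiple r r>0 Q-P≡)) = direction (Primitive-neg {v} pv) (multiple r r>0 (begin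
  P ⊖ Q                  ≡⟨ ⊖-flip P Q ⟩
  (- 1ℚ) ∙ (Q ⊖ P)       ≡⟨ cong ((- 1ℚ) ∙_) Q-P≡ ⟩
  (- 1ℚ) ∙ r ∙ ⟦ v ⟧     ≡⟨ ∙-comm (- 1ℚ) r ⟦ v ⟧ ⟩
  r ∙ (- 1ℚ) ∙ ⟦ v ⟧     ≡⟨ cong (r ∙_) (⟦⟧-neg v) ⟨
  r ∙ ⟦ neg v ⟧          ∎))
  where open ≡-Reasoning

Direction-along : ∀ {P Q P′ R v} → Direction P Q v → R ⊖ P′ ∝ Q ⊖ P → Direction P′ R v
Direction-along (direction pv Q-P∝v) R-P′∝ = direction pv (∝-trans R-P′∝ Q-P∝v)

Direction-shear : ∀ u {P Q P′ R v} → Direction P Q v → R ⊖ P′ ∝ φ u (Q ⊖ P) → Direction P′ R (φℤ u v)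
Direction-shear u {P′ = P′} {R} {v} (direction pv Q-P∝v) R-P′∝ =
  direction (Primitive-φℤ u {v} pv) (subst (R ⊖ P′ ∝_) (sym (⟦⟧-φℤ u v)) (∝-trans R-P′∝ (∝-shear ⟦ u ⟧ Q-P∝v)))

Bisector-swap : ∀ {Q R S u} → Bisector Q R S u → Bisector Q S R u
Bisector-swap {u = u} (bisector {v} {w} dR dS pu v+w∝u) = bisector dS dR pu (subst (_∝ ⟦ u ⟧) (⊕-comm ⟦ v ⟧ ⟦ w ⟧) v+w∝u)
  where
  ⊕-comm : ∀ x y → x ⊕ y ≡ y ⊕ x
  ⊕-comm (pt x₁ x₂) (pt y₁ y₂) = pt-≡ (+-comm x₁ y₁) (+-comm x₂ y₂)

OnBisectorAt-swap : ∀ {Q R S x} → OnBisectorAt Q R S x → OnBisectorAt Q S R x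
OnBisectorAt-swap (u , bis , on-line) = u , Bisector-swap bis , on-line

IsBarycentreOf-rotate : ∀ {P Q R c} → IsBarycentreOf P Q R c → IsBarycentreOf Q R P c
IsBarycentreOf-rotate (at-P , at-Q , at-R) = at-Q , at-R , at-P

IsBarycentreOf-swap : ∀ {P Q R c} → IsBarycentreOf P Q R c → IsBarycentreOf P R Q c
IsBarycentreOf-swap (at-P , at-Q , at-R) = OnBisectorAt-swap at-P , OnBisectorAt-swap at-R , OnBisectorAt-swap at-Q

Bisector-unique : ∀ {Q R S u u′} → Bisector Q R S u → Bisector Q R S u′ → u ≡ u′
Bisector-unique {u = u} {u′} (bisector {v} {w} dR dS pu (multiple r r>0 v+w≡))
                            (bisector {v′} {w′} dR′ dS′ pu′ (multiple r′ r′>0 v′+w′≡)) =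
  Primitive-unique {u} {u′} pu pu′ r>0 r′>0 (begin
    r ∙ ⟦ u ⟧            ≡⟨ v+w≡ ⟨
    ⟦ v ⟧ ⊕ ⟦ w ⟧        ≡⟨ cong₂ (λ a b → ⟦ a ⟧ ⊕ ⟦ b ⟧) (Direction-unique dR dR′) (Direction-unique dS dS′) ⟩
    ⟦ v′ ⟧ ⊕ ⟦ w′ ⟧      ≡⟨ v′+w′≡ ⟩
    r′ ∙ ⟦ u′ ⟧          ∎)
  where open ≡-Reasoning

straight-angle-has-no-bisector : ∀ {Q R S u v} → Direction Q R v → Direction Q S (neg v) → ¬ Bisector Q R S u
straight-angle-has-no-bisector {u = u} {v} dR dS (bisector {v′} {w′} dR′ dS′ pu (multiple r r>0 v′+w′≡)) =
  Primitive-nonzero {u} pu (∙-cancel-origin r>0 (begin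
    r ∙ ⟦ u ⟧               ≡⟨ v′+w′≡ ⟨
    ⟦ v′ ⟧ ⊕ ⟦ w′ ⟧         ≡⟨ cong₂ (λ a b → ⟦ a ⟧ ⊕ ⟦ b ⟧) (Direction-unique dR′ dR) (Direction-unique dS′ dS) ⟩
    ⟦ v ⟧ ⊕ ⟦ neg v ⟧       ≡⟨ cong (⟦ v ⟧ ⊕_) (⟦⟧-neg v) ⟩
    ⟦ v ⟧ ⊕ (- 1ℚ) ∙ ⟦ v ⟧  ≡⟨ cancel ⟦ v ⟧ ⟩
    origin                  ∎))
  where
  open ≡-Reasoning
  cancel : ∀ x → x ⊕ (- 1ℚ) ∙ x ≡ origin
  cancel (pt x₁ x₂) = pt-≡ (coordinate x₁) (coordinate x₂)
    where
    coordinate : ∀ x → x + - 1ℚ * x ≡ 0ℚ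
    coordinate = solve-∀ ℚ-ring

OnBisectorAt-along : ∀ {Q R S R′ S′ c} → OnBisectorAt Q R S c → R′ ⊖ Q ∝ R ⊖ Q → S′ ⊖ Q ∝ S ⊖ Q → OnBisectorAt Q R′ S′ c
OnBisectorAt-along (u , bisector dR dS pu v+w∝u , on-line) R′∝ S′∝ =
  u , bisector (Direction-along dR R′∝) (Direction-along dS S′∝) pu v+w∝u , on-line

OnBisectorAt-shear : ∀ u {A R S c A′ R′ S′} → OnBisectorAt A R S c
  → R′ ⊖ A′ ∝ φ u (R ⊖ A) → S′ ⊖ A′ ∝ φ u (S ⊖ A) → c ⊖ A′ ≡ φ u (c ⊖ A) → OnBisectorAt A′ R′ S′ c
OnBisectorAt-shear u {A} {c = c} {A′} (e , bisector {v} {w} dR dS pe (multiple r r>0 v+w≡) , t , c≡) R′∝ S′∝ c-A′≡ =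
  φℤ u e , bisector (Direction-shear u dR R′∝) (Direction-shear u dS S′∝) (Primitive-φℤ u {e} pe) (multiple r r>0 sheared-sum) , t , c-on-line
  where
  open ≡-Reasoning
  sheared-sum : ⟦ φℤ u v ⟧ ⊕ ⟦ φℤ u w ⟧ ≡ r ∙ ⟦ φℤ u e ⟧
  sheared-sum = begin
    ⟦ φℤ u v ⟧ ⊕ ⟦ φℤ u w ⟧         ≡⟨ cong₂ _⊕_ (⟦⟧-φℤ u v) (⟦⟧-φℤ u w) ⟩
    φ u ⟦ v ⟧ ⊕ φ u ⟦ w ⟧           ≡⟨ shear-⊕ ⟦ u ⟧ ⟦ v ⟧ ⟦ w ⟧ ⟨
    φ u (⟦ v ⟧ ⊕ ⟦ w ⟧)             ≡⟨ cong (φ u) v+w≡ ⟩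
    φ u (r ∙ ⟦ e ⟧)                 ≡⟨ shear-∙ ⟦ u ⟧ r ⟦ e ⟧ ⟩
    r ∙ φ u ⟦ e ⟧                   ≡⟨ cong (r ∙_) (⟦⟧-φℤ u e) ⟨
    r ∙ ⟦ φℤ u e ⟧                  ∎
  c-on-line : c ≡ A′ ⊕ (t · φℤ u e)
  c-on-line = begin
    c                               ≡⟨ ⊖-⊕-cancel A′ c ⟨
    A′ ⊕ (c ⊖ A′)                   ≡⟨ cong (A′ ⊕_) c-A′≡ ⟩
    A′ ⊕ φ u (c ⊖ A)                ≡⟨ cong (λ x → A′ ⊕ φ u (x ⊖ A)) c≡ ⟩
    A′ ⊕ φ u ((A ⊕ (t · e)) ⊖ A)    ≡⟨ cong (λ x → A′ ⊕ φ u x) (⊕-⊖-cancel A (t · e)) ⟩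
    A′ ⊕ φ u (t ∙ ⟦ e ⟧)            ≡⟨ cong (A′ ⊕_) (shear-∙ ⟦ u ⟧ t ⟦ e ⟧) ⟩
    A′ ⊕ (t ∙ φ u ⟦ e ⟧)            ≡⟨ cong (λ x → A′ ⊕ (t ∙ x)) (⟦⟧-φℤ u e) ⟨
    A′ ⊕ (t · φℤ u e)               ∎

sheared-straight-angle-bisector : ∀ u {X R S v} → Primitive u → Direction X R (φℤ u v) → Direction X S (neg v)
  → 0ℚ < det ⟦ v ⟧ ⟦ u ⟧ → Bisector X R S (neg u)
sheared-straight-angle-bisector u {v = v} pu dR dS vu>0 =
  bisector dR dS (Primitive-neg {u} pu) (multiple (det ⟦ v ⟧ ⟦ u ⟧) vu>0 (begin
    ⟦ φℤ u v ⟧ ⊕ ⟦ neg v ⟧                 ≡⟨ cong₂ _⊕_ (⟦⟧-φℤ u v) (⟦⟧-neg v) ⟩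
    φ u ⟦ v ⟧ ⊕ (- 1ℚ) ∙ ⟦ v ⟧             ≡⟨ displacement ⟦ u ⟧ ⟦ v ⟧ ⟩
    det ⟦ v ⟧ ⟦ u ⟧ ∙ (- 1ℚ) ∙ ⟦ u ⟧       ≡⟨ cong (det ⟦ v ⟧ ⟦ u ⟧ ∙_) (⟦⟧-neg u) ⟨
    det ⟦ v ⟧ ⟦ u ⟧ ∙ ⟦ neg u ⟧            ∎))
  where
  open ≡-Reasoning
  displacement : ∀ k x → shear k x ⊕ (- 1ℚ) ∙ x ≡ det x k ∙ (- 1ℚ) ∙ k
  displacement (pt k₁ k₂) (pt x₁ x₂) = pt-≡ (coordinate k₁ x₁) (coordinate k₂ x₂)
    where
    coordinate : ∀ kᵢ xᵢ → xᵢ + (k₁ * x₂ - k₂ * x₁) * kᵢ + - 1ℚ * xᵢ ≡ (x₁ * k₂ - x₂ * k₁) * (- 1ℚ * kᵢ)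
    coordinate kᵢ xᵢ = solve (kᵢ ∷ xᵢ ∷ k₁ ∷ k₂ ∷ x₁ ∷ x₂ ∷ []) ℚ-ring

-- Closed triangles as point sets

record Hull (P Q R x : Pt) : Set where
  constructor convex-combination
  field
    w₀ w₁ w₂ : ℚ
    w₀≥0 : 0ℚ ≤ w₀
    w₁≥0 : 0ℚ ≤ w₁
    w₂≥0 : 0ℚ ≤ w₂
    sum≡1 : w₀ + w₁ + w₂ ≡ 1ℚ
    x≡ : x ≡ (w₀ ∙ P ⊕ w₁ ∙ Q) ⊕ w₂ ∙ R

InTri⇒Hull : ∀ T {x} → InTri T x → Hull (T zero) (T (suc zero)) (T (suc (suc zero))) x
InTri⇒Hull _ (w , w≥0 , sum≡1 , x≡) = convex-combination _ _ _ (w≥0 zero) (w≥0 (suc zero)) (w≥0 (suc (suc zero))) sum≡1 x≡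

Hull⇒InTri : ∀ T {x} → Hull (T zero) (T (suc zero)) (T (suc (suc zero))) x → InTri T x
Hull⇒InTri _ (convex-combination w₀ w₁ w₂ w₀≥0 w₁≥0 w₂≥0 sum≡1 x≡) = weight , weight≥0 , sum≡1 , x≡
  where
  weight : Fin 3 → ℚ
  weight zero = w₀
  weight (suc zero) = w₁
  weight (suc (suc zero)) = w₂
  weight≥0 : ∀ j → 0ℚ ≤ weight j
  weight≥0 zero = w₀≥0
  weight≥0 (suc zero) = w₁≥0
  weight≥0 (suc (suc zero)) = w₂≥0

Hull-rotate : ∀ {P Q R x} → Hull P Q R x → Hull Q R P x
Hull-rotate {P} {Q} {R} (convex-combination w₀ w₁ w₂ w₀≥0 w₁≥0 w₂≥0 sum≡1 refl) =
  convex-combination w₁ w₂ w₀ w₁≥0 w₂≥0 w₀≥0 (trans (rotate-sum w₀ w₁ w₂) sum≡1) (rotate-combination P Q R)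
  where
  rotate-sum : ∀ a b c → b + c + a ≡ a + b + c
  rotate-sum = solve-∀ ℚ-ring
  rotate-combination : ∀ P Q R → (w₀ ∙ P ⊕ w₁ ∙ Q) ⊕ w₂ ∙ R ≡ (w₁ ∙ Q ⊕ w₂ ∙ R) ⊕ w₀ ∙ P
  rotate-combination (pt p₁ p₂) (pt q₁ q₂) (pt r₁ r₂) = pt-≡ (coordinate p₁ q₁ r₁) (coordinate p₂ q₂ r₂)
    where
    coordinate : ∀ p q r → w₀ * p + w₁ * q + w₂ * r ≡ w₁ * q + w₂ * r + w₀ * p
    coordinate p q r = solve (w₀ ∷ w₁ ∷ w₂ ∷ p ∷ q ∷ r ∷ []) ℚ-ring

Hull-swap : ∀ {P Q R x} → Hull P Q R x → Hull P R Q x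
Hull-swap {P} {Q} {R} (convex-combination w₀ w₁ w₂ w₀≥0 w₁≥0 w₂≥0 sum≡1 refl) =
  convex-combination w₀ w₂ w₁ w₀≥0 w₂≥0 w₁≥0 (trans (swap-sum w₀ w₁ w₂) sum≡1) (swap-combination P Q R)
  where
  swap-sum : ∀ a b c → a + c + b ≡ a + b + c
  swap-sum = solve-∀ ℚ-ring
  swap-combination : ∀ P Q R → (w₀ ∙ P ⊕ w₁ ∙ Q) ⊕ w₂ ∙ R ≡ (w₀ ∙ P ⊕ w₂ ∙ R) ⊕ w₁ ∙ Q
  swap-combination (pt p₁ p₂) (pt q₁ q₂) (pt r₁ r₂) = pt-≡ (coordinate p₁ q₁ r₁) (coordinate p₂ q₂ r₂)
    where
    coordinate : ∀ p q r → w₀ * p + w₁ * q + w₂ * r ≡ w₀ * p + w₂ * r + w₁ * q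
    coordinate p q r = solve (w₀ ∷ w₁ ∷ w₂ ∷ p ∷ q ∷ r ∷ []) ℚ-ring

Hull-vertex : ∀ P Q R → Hull P Q R P
Hull-vertex (pt p₁ p₂) (pt q₁ q₂) (pt r₁ r₂) =
  convex-combination 1ℚ 0ℚ 0ℚ (<⇒≤ 0<1) ≤-refl ≤-refl refl (pt-≡ (coordinate p₁ q₁ r₁) (coordinate p₂ q₂ r₂))
  where
  coordinate : ∀ p q r → p ≡ 1ℚ * p + 0ℚ * q + 0ℚ * r
  coordinate = solve-∀ ℚ-ring

Hull-edge : ∀ P Q R {a b} → 0ℚ ≤ a → 0ℚ ≤ b → a + b ≡ 1ℚ → Hull P Q R (a ∙ Q ⊕ b ∙ R)
Hull-edge (pt p₁ p₂) (pt q₁ q₂) (pt r₁ r₂) {a} {b} a≥0 b≥0 a+b≡1 =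
  convex-combination 0ℚ a b ≤-refl a≥0 b≥0 (trans (+-identityˡ-assoc a b) a+b≡1)
    (pt-≡ (coordinate a b p₁ q₁ r₁) (coordinate a b p₂ q₂ r₂))
  where
  +-identityˡ-assoc : ∀ a b → 0ℚ + a + b ≡ a + b
  +-identityˡ-assoc = solve-∀ ℚ-ring
  coordinate : ∀ a b p q r → a * q + b * r ≡ 0ℚ * p + a * q + b * r
  coordinate = solve-∀ ℚ-ring

det-convex-combination : ∀ {P Q R x} o n → (h : Hull P Q R x) → let open Hull h in
  det (x ⊖ o) n ≡ w₀ * det (P ⊖ o) n + w₁ * det (Q ⊖ o) n + w₂ * det (R ⊖ o) n
det-convex-combination {P} {Q} {R} o n (convex-combination w₀ w₁ w₂ _ _ _ sum≡1 refl) =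
  ≡-modulo (w₀ + w₁ + w₂ - 1ℚ) (det o n) sum-1≡0 (expand P Q R o n)
  where
  sum-1≡0 : w₀ + w₁ + w₂ - 1ℚ ≡ 0ℚ
  sum-1≡0 = ≡⇒difference-zero sum≡1
  expand : ∀ P Q R o n → det (((w₀ ∙ P ⊕ w₁ ∙ Q) ⊕ w₂ ∙ R) ⊖ o) n
    ≡ (w₀ * det (P ⊖ o) n + w₁ * det (Q ⊖ o) n + w₂ * det (R ⊖ o) n) + (w₀ + w₁ + w₂ - 1ℚ) * det o n
  expand (pt p₁ p₂) (pt q₁ q₂) (pt r₁ r₂) (pt o₁ o₂) (pt n₁ n₂) = identity
    where
    identity : let d : ℚ → ℚ → ℚ
                   d x₁ x₂ = (x₁ - o₁) * n₂ - (x₂ - o₂) * n₁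
               in d (w₀ * p₁ + w₁ * q₁ + w₂ * r₁) (w₀ * p₂ + w₁ * q₂ + w₂ * r₂)
                  ≡ (w₀ * d p₁ p₂ + w₁ * d q₁ q₂ + w₂ * d r₁ r₂) + (w₀ + w₁ + w₂ - 1ℚ) * (o₁ * n₂ - o₂ * n₁)
    identity = solve (w₀ ∷ w₁ ∷ w₂ ∷ p₁ ∷ p₂ ∷ q₁ ∷ q₂ ∷ r₁ ∷ r₂ ∷ o₁ ∷ o₂ ∷ n₁ ∷ n₂ ∷ []) ℚ-ring

Hull-det-≤ : ∀ {P Q R x} o n {m} → det (P ⊖ o) n ≤ m → det (Q ⊖ o) n ≤ m → det (R ⊖ o) n ≤ m
  → Hull P Q R x → det (x ⊖ o) n ≤ m
Hull-det-≤ {P} {Q} {R} {x} o n {m} P≤ Q≤ R≤ h@(convex-combination w₀ w₁ w₂ w₀≥0 w₁≥0 w₂≥0 sum≡1 _) = begin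
  det (x ⊖ o) n                                                  ≡⟨ det-convex-combination o n h ⟩
  w₀ * det (P ⊖ o) n + w₁ * det (Q ⊖ o) n + w₂ * det (R ⊖ o) n   ≤⟨ weighted-sum-mono w₀≥0 w₁≥0 w₂≥0 P≤ Q≤ R≤ ⟩
  w₀ * m + w₁ * m + w₂ * m                                       ≡⟨ weighted-sum-constant w₀ w₁ w₂ m sum≡1 ⟩
  m                                                              ∎
  where open ≤-Reasoning

Hull-det-≥ : ∀ {P Q R x} o n {m} → m ≤ det (P ⊖ o) n → m ≤ det (Q ⊖ o) n → m ≤ det (R ⊖ o) n
  → Hull P Q R x → m ≤ det (x ⊖ o) n
Hull-det-≥ {P} {Q} {R} {x} o n {m} P≥ Q≥ R≥ h@(convex-combination w₀ w₁ w₂ w₀≥0 w₁≥0 w₂≥0 sum≡1 _) = begin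
  m                                                              ≡⟨ weighted-sum-constant w₀ w₁ w₂ m sum≡1 ⟨
  w₀ * m + w₁ * m + w₂ * m                                       ≤⟨ weighted-sum-mono w₀≥0 w₁≥0 w₂≥0 P≥ Q≥ R≥ ⟩
  w₀ * det (P ⊖ o) n + w₁ * det (Q ⊖ o) n + w₂ * det (R ⊖ o) n   ≡⟨ det-convex-combination o n h ⟨
  det (x ⊖ o) n                                                  ∎
  where open ≤-Reasoning

-- The mutation map

mutMap-sheared : ∀ u p y → 0ℚ ≤ det (y ⊖ p) ⟦ u ⟧ → mutMap u p y ≡ p ⊕ φ u (y ⊖ p)
mutMap-sheared u p y y≥0 with 0ℚ ≤? det-uv (y ⊖ p) u
... | yes _ = refl
... | no y≱0 = ⊥-elim (y≱0 y≥0)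

mutMap-fixed : ∀ u p y → det (y ⊖ p) ⟦ u ⟧ < 0ℚ → mutMap u p y ≡ y
mutMap-fixed u p y y<0 with 0ℚ ≤? det-uv (y ⊖ p) u
... | yes y≥0 = ⊥-elim (<-irrefl refl (<-≤-trans y<0 y≥0))
... | no _ = ⊖-⊕-cancel p y

mutMap-det : ∀ u p y → det (mutMap u p y ⊖ p) ⟦ u ⟧ ≡ det (y ⊖ p) ⟦ u ⟧
mutMap-det u p y with 0ℚ ≤? det-uv (y ⊖ p) u
... | yes _ = trans (cong (λ z → det z ⟦ u ⟧) (⊕-⊖-cancel p (φ u (y ⊖ p)))) (det-shear ⟦ u ⟧ (y ⊖ p))
... | no _ = cong (λ z → det z ⟦ u ⟧) (⊕-⊖-cancel p (y ⊖ p))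

mutMap-axis : ∀ u p y → det (y ⊖ p) ⟦ u ⟧ ≡ 0ℚ → mutMap u p y ≡ y
mutMap-axis u p y y∥u with 0ℚ ≤? det-uv (y ⊖ p) u
... | yes _ = trans (cong (p ⊕_) (shear-fixes-axis ⟦ u ⟧ (y ⊖ p) y∥u)) (⊖-⊕-cancel p y)
... | no _ = ⊖-⊕-cancel p y

axis-det : ∀ p k s → det ((p ⊕ s ∙ k) ⊖ p) k ≡ 0ℚ
axis-det (pt p₁ p₂) (pt k₁ k₂) s = lemma p₁ p₂ k₁ k₂ s
  where
  lemma : ∀ p₁ p₂ k₁ k₂ s → (p₁ + s * k₁ - p₁) * k₂ - (p₂ + s * k₂ - p₂) * k₁ ≡ 0ℚ
  lemma = solve-∀ ℚ-ring

MutatesOnto : Pt → Pt → Pt → Vec2 → Pt → Pt → Pt → Set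
MutatesOnto p A B u X A′ B′ = ∀ x → Hull X A′ B′ x ⇔ (∃[ y ] (Hull p A B y × x ≡ mutMap u p y))

-- The mutation preserves det (_ ⊖ p) ⟦ u ⟧ and fixes the points where it vanishes,
-- so on the line through p along u the two triangles agree.
module _ {p A B u X A′ B′} (onto : MutatesOnto p A B u X A′ B′) {x} (x∥u : det (x ⊖ p) ⟦ u ⟧ ≡ 0ℚ) where

  axis-point-of-image : Hull X A′ B′ x → Hull p A B x
  axis-point-of-image x∈ = preimage-is-x (Equivalence.to (onto x) x∈)
    where
    preimage-is-x : ∃[ y ] (Hull p A B y × x ≡ mutMap u p y) → Hull p A B x
    preimage-is-x (y , y∈ , x≡My) = subst (Hull p A B) y≡x y∈
      where
      y∥u : det (y ⊖ p) ⟦ u ⟧ ≡ 0ℚ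
      y∥u = trans (sym (mutMap-det u p y)) (trans (cong (λ z → det (z ⊖ p) ⟦ u ⟧) (sym x≡My)) x∥u)
      y≡x : y ≡ x
      y≡x = trans (sym (mutMap-axis u p y y∥u)) (sym x≡My)

  axis-point-of-domain : Hull p A B x → Hull X A′ B′ x
  axis-point-of-domain x∈ = Equivalence.from (onto x) (x , x∈ , sym (mutMap-axis u p x x∥u))

-- The algebra of a corner

-- The coordinates are module parameters so that the ring solver can use them as variables.

module CornerAlgebra (p₁ p₂ A₁ A₂ B₁ B₂ k₁ k₂ : ℚ) where

  p A B k : Pt
  p = pt p₁ p₂
  A = pt A₁ A₂
  B = pt B₁ B₂
  k = pt k₁ k₂

  α β D : ℚ
  α = det (A ⊖ p) k
  β = det k (B ⊖ p)
  D = det (A ⊖ p) (B ⊖ p)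

  A* : Pt
  A* = p ⊕ shear k (A ⊖ p)

  axis : ℚ → Pt
  axis s = p ⊕ s ∙ k

  private
    xs : List ℚ
    xs = p₁ ∷ p₂ ∷ A₁ ∷ A₂ ∷ B₁ ∷ B₂ ∷ k₁ ∷ k₂ ∷ []

  -- In the coordinate identities below a = A - p, b = B - p, and κ = det k a = - α.

  axis-zero : axis 0ℚ ≡ p
  axis-zero = pt-≡ (coordinate p₁ k₁) (coordinate p₂ k₂)
    where
    coordinate : ∀ pᵢ kᵢ → pᵢ + 0ℚ * kᵢ ≡ pᵢ
    coordinate = solve-∀ ℚ-ring

  axis-shift : ∀ t t₀ → axis t₀ ≡ axis t ⊕ (t - t₀) ∙ (- 1ℚ) ∙ k
  axis-shift t t₀ = pt-≡ (coordinate p₁ k₁) (coordinate p₂ k₂)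
    where
    coordinate : ∀ pᵢ kᵢ → pᵢ + t₀ * kᵢ ≡ pᵢ + t * kᵢ + (t - t₀) * (- 1ℚ * kᵢ)
    coordinate pᵢ kᵢ = solve (pᵢ ∷ kᵢ ∷ t ∷ t₀ ∷ []) ℚ-ring

  axis-det-b : ∀ s → det (axis s ⊖ p) (B ⊖ p) ≡ s * β
  axis-det-b s = identity
    where
    identity : let b₁ = B₁ - p₁; b₂ = B₂ - p₂ in (p₁ + s * k₁ - p₁) * b₂ - (p₂ + s * k₂ - p₂) * b₁ ≡ s * (k₁ * b₂ - k₂ * b₁)
    identity = solve (s ∷ xs) ℚ-ring

  A*-det-b : det (A* ⊖ p) (B ⊖ p) ≡ D - α * β
  A*-det-b = identity
    where
    identity : let a₁ = A₁ - p₁; a₂ = A₂ - p₂; b₁ = B₁ - p₁; b₂ = B₂ - p₂; κ = k₁ * a₂ - k₂ * a₁ in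
      (p₁ + (a₁ + κ * k₁) - p₁) * b₂ - (p₂ + (a₂ + κ * k₂) - p₂) * b₁ ≡ (a₁ * b₂ - a₂ * b₁) - (a₁ * k₂ - a₂ * k₁) * (k₁ * b₂ - k₂ * b₁)
    identity = solve xs ℚ-ring

  A-det-AB : det (A ⊖ p) (B ⊖ A) ≡ D
  A-det-AB = identity
    where
    identity : let a₁ = A₁ - p₁; a₂ = A₂ - p₂; b₁ = B₁ - p₁; b₂ = B₂ - p₂ in a₁ * (B₂ - A₂) - a₂ * (B₁ - A₁) ≡ a₁ * b₂ - a₂ * b₁
    identity = solve xs ℚ-ring

  B-det-AB : det (B ⊖ p) (B ⊖ A) ≡ D
  B-det-AB = identity
    where
    identity : let a₁ = A₁ - p₁; a₂ = A₂ - p₂; b₁ = B₁ - p₁; b₂ = B₂ - p₂ in b₁ * (B₂ - A₂) - b₂ * (B₁ - A₁) ≡ a₁ * b₂ - a₂ * b₁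
    identity = solve xs ℚ-ring

  axis-det-AB : ∀ s → det (axis s ⊖ p) (B ⊖ A) ≡ s * (α + β)
  axis-det-AB s = identity
    where
    identity : let a₁ = A₁ - p₁; a₂ = A₂ - p₂; b₁ = B₁ - p₁; b₂ = B₂ - p₂ in
      (p₁ + s * k₁ - p₁) * (B₂ - A₂) - (p₂ + s * k₂ - p₂) * (B₁ - A₁) ≡ s * ((a₁ * k₂ - a₂ * k₁) + (k₁ * b₂ - k₂ * b₁))
    identity = solve (s ∷ xs) ℚ-ring

  p-det-A*B : det (p ⊖ B) (B ⊖ A*) ≡ - (D - α * β)
  p-det-A*B = identity
    where
    identity : let a₁ = A₁ - p₁; a₂ = A₂ - p₂; b₁ = B₁ - p₁; b₂ = B₂ - p₂; κ = k₁ * a₂ - k₂ * a₁ in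
      (p₁ - B₁) * (B₂ - (p₂ + (a₂ + κ * k₂))) - (p₂ - B₂) * (B₁ - (p₁ + (a₁ + κ * k₁)))
        ≡ - ((a₁ * b₂ - a₂ * b₁) - (a₁ * k₂ - a₂ * k₁) * (k₁ * b₂ - k₂ * b₁))
    identity = solve xs ℚ-ring

  axis-det-A*B : ∀ s → det (axis s ⊖ B) (B ⊖ A*) ≡ s * (α + β) - (D - α * β)
  axis-det-A*B s = identity
    where
    identity : let a₁ = A₁ - p₁; a₂ = A₂ - p₂; b₁ = B₁ - p₁; b₂ = B₂ - p₂; κ = k₁ * a₂ - k₂ * a₁
                   α = a₁ * k₂ - a₂ * k₁; β = k₁ * b₂ - k₂ * b₁ in
      (p₁ + s * k₁ - B₁) * (B₂ - (p₂ + (a₂ + κ * k₂))) - (p₂ + s * k₂ - B₂) * (B₁ - (p₁ + (a₁ + κ * k₁)))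
        ≡ s * (α + β) - ((a₁ * b₂ - a₂ * b₁) - α * β)
    identity = solve (s ∷ xs) ℚ-ring

  AB-det-k : det (A ⊖ B) k ≡ α + β
  AB-det-k = identity
    where
    identity : let a₁ = A₁ - p₁; a₂ = A₂ - p₂; b₁ = B₁ - p₁; b₂ = B₂ - p₂ in
      (A₁ - B₁) * k₂ - (A₂ - B₂) * k₁ ≡ (a₁ * k₂ - a₂ * k₁) + (k₁ * b₂ - k₂ * b₁)
    identity = solve xs ℚ-ring

  axis-from-A* : ∀ s → axis s ⊖ A* ≡ shear k (axis s ⊖ A)
  axis-from-A* s = pt-≡ (coordinate p₁ A₁ k₁) (coordinate p₂ A₂ k₂)
    where
    coordinate : ∀ pᵢ Aᵢ kᵢ → let κ = k₁ * (A₂ - p₂) - k₂ * (A₁ - p₁) in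
      pᵢ + s * kᵢ - (pᵢ + ((Aᵢ - pᵢ) + κ * kᵢ)) ≡ pᵢ + s * kᵢ - Aᵢ + (k₁ * (p₂ + s * k₂ - A₂) - k₂ * (p₁ + s * k₁ - A₁)) * kᵢ
    coordinate pᵢ Aᵢ kᵢ = solve (pᵢ ∷ Aᵢ ∷ kᵢ ∷ s ∷ xs) ℚ-ring

  axis-meets-AB : ∀ {w} → (α + β) * w ≡ 1ℚ → axis (w * D) ≡ (w * β) ∙ A ⊕ (w * α) ∙ B
  axis-meets-AB {w} w≡ = ≡-moduloᵖ ((α + β) * w - 1ℚ) ((- 1ℚ) ∙ p) (≡⇒difference-zero w≡) (pt-≡ x-coordinate y-coordinate)
    where
    x-coordinate : let a₁ = A₁ - p₁; a₂ = A₂ - p₂; b₁ = B₁ - p₁; b₂ = B₂ - p₂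
                       α = a₁ * k₂ - a₂ * k₁; β = k₁ * b₂ - k₂ * b₁; D = a₁ * b₂ - a₂ * b₁ in
      p₁ + w * D * k₁ ≡ w * β * A₁ + w * α * B₁ + ((α + β) * w - 1ℚ) * (- 1ℚ * p₁)
    x-coordinate = solve (w ∷ xs) ℚ-ring
    y-coordinate : let a₁ = A₁ - p₁; a₂ = A₂ - p₂; b₁ = B₁ - p₁; b₂ = B₂ - p₂
                       α = a₁ * k₂ - a₂ * k₁; β = k₁ * b₂ - k₂ * b₁; D = a₁ * b₂ - a₂ * b₁ in
      p₂ + w * D * k₂ ≡ w * β * A₂ + w * α * B₂ + ((α + β) * w - 1ℚ) * (- 1ℚ * p₂)
    y-coordinate = solve (w ∷ xs) ℚ-ring

  axis-meets-A*B : ∀ {w} → (α + β) * w ≡ 1ℚ → axis (w * (D - α * β)) ≡ (w * β) ∙ A* ⊕ (w * α) ∙ B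
  axis-meets-A*B {w} w≡ = ≡-moduloᵖ ((α + β) * w - 1ℚ) ((- 1ℚ) ∙ p) (≡⇒difference-zero w≡) (pt-≡ x-coordinate y-coordinate)
    where
    x-coordinate : let a₁ = A₁ - p₁; a₂ = A₂ - p₂; b₁ = B₁ - p₁; b₂ = B₂ - p₂; κ = k₁ * a₂ - k₂ * a₁
                       α = a₁ * k₂ - a₂ * k₁; β = k₁ * b₂ - k₂ * b₁; D = a₁ * b₂ - a₂ * b₁ in
      p₁ + w * (D - α * β) * k₁ ≡ w * β * (p₁ + (a₁ + κ * k₁)) + w * α * B₁ + ((α + β) * w - 1ℚ) * (- 1ℚ * p₁)
    x-coordinate = solve (w ∷ xs) ℚ-ring
    y-coordinate : let a₁ = A₁ - p₁; a₂ = A₂ - p₂; b₁ = B₁ - p₁; b₂ = B₂ - p₂; κ = k₁ * a₂ - k₂ * a₁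
                       α = a₁ * k₂ - a₂ * k₁; β = k₁ * b₂ - k₂ * b₁; D = a₁ * b₂ - a₂ * b₁ in
      p₂ + w * (D - α * β) * k₂ ≡ w * β * (p₂ + (a₂ + κ * k₂)) + w * α * B₂ + ((α + β) * w - 1ℚ) * (- 1ℚ * p₂)
    y-coordinate = solve (w ∷ xs) ℚ-ring

  -- t * (α + β) ≡ D says that the apex axis t lies on AB.
  module _ {t} (t≡ : t * (α + β) ≡ D) where

    private
      excess≡0 : t * (α + β) - D ≡ 0ℚ
      excess≡0 = ≡⇒difference-zero t≡

    apex-A*-side : (α + β) ∙ (A* ⊖ axis t) ≡ α ∙ shear k (A ⊖ B)
    apex-A*-side = ≡-moduloᵖ (t * (α + β) - D) ((- 1ℚ) ∙ k) excess≡0 (pt-≡ x-coordinate y-coordinate)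
      where
      x-coordinate : let a₁ = A₁ - p₁; a₂ = A₂ - p₂; b₁ = B₁ - p₁; b₂ = B₂ - p₂; κ = k₁ * a₂ - k₂ * a₁
                         α = a₁ * k₂ - a₂ * k₁; β = k₁ * b₂ - k₂ * b₁; D = a₁ * b₂ - a₂ * b₁ in
        (α + β) * (p₁ + (a₁ + κ * k₁) - (p₁ + t * k₁))
          ≡ α * (A₁ - B₁ + (k₁ * (A₂ - B₂) - k₂ * (A₁ - B₁)) * k₁) + (t * (α + β) - D) * (- 1ℚ * k₁)
      x-coordinate = solve (t ∷ xs) ℚ-ring
      y-coordinate : let a₁ = A₁ - p₁; a₂ = A₂ - p₂; b₁ = B₁ - p₁; b₂ = B₂ - p₂; κ = k₁ * a₂ - k₂ * a₁
                         α = a₁ * k₂ - a₂ * k₁; β = k₁ * b₂ - k₂ * b₁; D = a₁ * b₂ - a₂ * b₁ in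
        (α + β) * (p₂ + (a₂ + κ * k₂) - (p₂ + t * k₂))
          ≡ α * (A₂ - B₂ + (k₁ * (A₂ - B₂) - k₂ * (A₁ - B₁)) * k₂) + (t * (α + β) - D) * (- 1ℚ * k₂)
      y-coordinate = solve (t ∷ xs) ℚ-ring

    apex-B-side : (α + β) ∙ (B ⊖ axis t) ≡ β ∙ (B ⊖ A)
    apex-B-side = ≡-moduloᵖ (t * (α + β) - D) ((- 1ℚ) ∙ k) excess≡0 (pt-≡ x-coordinate y-coordinate)
      where
      x-coordinate : let a₁ = A₁ - p₁; a₂ = A₂ - p₂; b₁ = B₁ - p₁; b₂ = B₂ - p₂
                         α = a₁ * k₂ - a₂ * k₁; β = k₁ * b₂ - k₂ * b₁; D = a₁ * b₂ - a₂ * b₁ in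
        (α + β) * (B₁ - (p₁ + t * k₁)) ≡ β * (B₁ - A₁) + (t * (α + β) - D) * (- 1ℚ * k₁)
      x-coordinate = solve (t ∷ xs) ℚ-ring
      y-coordinate : let a₁ = A₁ - p₁; a₂ = A₂ - p₂; b₁ = B₁ - p₁; b₂ = B₂ - p₂
                         α = a₁ * k₂ - a₂ * k₁; β = k₁ * b₂ - k₂ * b₁; D = a₁ * b₂ - a₂ * b₁ in
        (α + β) * (B₂ - (p₂ + t * k₂)) ≡ β * (B₂ - A₂) + (t * (α + β) - D) * (- 1ℚ * k₂)
      y-coordinate = solve (t ∷ xs) ℚ-ring

  -- When D = α * β the old vertex p lies on the side A* B.
  p-between-A*-B : D ≡ α * β → β ∙ (A* ⊖ p) ≡ α ∙ (p ⊖ B)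
  p-between-A*-B D≡ = ≡-moduloᵖ (D - α * β) k (≡⇒difference-zero D≡) (pt-≡ x-coordinate y-coordinate)
    where
    x-coordinate : let a₁ = A₁ - p₁; a₂ = A₂ - p₂; b₁ = B₁ - p₁; b₂ = B₂ - p₂; κ = k₁ * a₂ - k₂ * a₁
                       α = a₁ * k₂ - a₂ * k₁; β = k₁ * b₂ - k₂ * b₁; D = a₁ * b₂ - a₂ * b₁ in
      β * (p₁ + (a₁ + κ * k₁) - p₁) ≡ α * (p₁ - B₁) + (D - α * β) * k₁
    x-coordinate = solve xs ℚ-ring
    y-coordinate : let a₁ = A₁ - p₁; a₂ = A₂ - p₂; b₁ = B₁ - p₁; b₂ = B₂ - p₂; κ = k₁ * a₂ - k₂ * a₁
                       α = a₁ * k₂ - a₂ * k₁; β = k₁ * b₂ - k₂ * b₁; D = a₁ * b₂ - a₂ * b₁ in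
      β * (p₂ + (a₂ + κ * k₂) - p₂) ≡ α * (p₂ - B₂) + (D - α * β) * k₂
    y-coordinate = solve xs ℚ-ring

-- Mutating a positively oriented corner

PositiveCorner : Pt → Pt → Pt → Vec2 → Set
PositiveCorner p A B u = 0ℚ < det (A ⊖ p) ⟦ u ⟧ × 0ℚ < det ⟦ u ⟧ (B ⊖ p) × 0ℚ < det (A ⊖ p) (B ⊖ p)

module Corner (p A B : Pt) (u : Vec2) where

  open CornerAlgebra (px p) (py p) (px A) (py A) (px B) (py B) (toℚ (vx u)) (toℚ (vy u)) hiding (p; A; B; k)

  image-of-A : 0ℚ < α → mutMap u p A ≡ A*
  image-of-A α>0 = mutMap-sheared u p A (<⇒≤ α>0)

  image-of-B : 0ℚ < β → mutMap u p B ≡ B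
  image-of-B β>0 = mutMap-fixed u p B (subst (_< 0ℚ) (sym (det-antisym (B ⊖ p) ⟦ u ⟧)) (neg-antimono-< β>0))

  -- T is the triangle p A B and T′ the triangle (axis t) A* B. Testing them against the
  -- functionals det (_ ⊖ p) (B ⊖ p), det (_ ⊖ p) (B ⊖ A) and det (_ ⊖ B) (B ⊖ A*) at points of
  -- the bisector line, where they agree, forces D ≡ α * β and t * (α + β) ≡ D.
  module Shape {t} (α>0 : 0ℚ < α) (β>0 : 0ℚ < β) (D>0 : 0ℚ < D) (onto : MutatesOnto p A B u (axis t) A* B) where

    α+β>0 : 0ℚ < α + β
    α+β>0 = +-mono-< α>0 β>0

    w : ℚ
    w = proj₁ (pos-inverse α+β>0)

    w≡ : (α + β) * w ≡ 1ℚ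
    w≡ = proj₁ (proj₂ (pos-inverse α+β>0))

    w>0 : 0ℚ < w
    w>0 = proj₂ (proj₂ (pos-inverse α+β>0))

    weights-sum : w * β + w * α ≡ 1ℚ
    weights-sum = trans (lemma α β w) w≡
      where
      lemma : ∀ a b w → w * b + w * a ≡ (a + b) * w
      lemma = solve-∀ ℚ-ring

    in-T⇒b-side : ∀ {x} → Hull p A B x → 0ℚ ≤ det (x ⊖ p) (B ⊖ p)
    in-T⇒b-side = Hull-det-≥ p (B ⊖ p) (≤-reflexive (sym (det-origin p (B ⊖ p)))) (<⇒≤ D>0) (≤-reflexive (sym (det-self (B ⊖ p))))

    in-T⇒below-AB : ∀ {x} → Hull p A B x → det (x ⊖ p) (B ⊖ A) ≤ D
    in-T⇒below-AB = Hull-det-≤ p (B ⊖ A) (subst (_≤ D) (sym (det-origin p (B ⊖ A))) (<⇒≤ D>0)) (≤-reflexive A-det-AB) (≤-reflexive B-det-AB)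

    apex-in-T : Hull p A B (axis t)
    apex-in-T = axis-point-of-image onto (axis-det p ⟦ u ⟧ t) (Hull-vertex (axis t) A* B)

    t≥0 : 0ℚ ≤ t
    t≥0 = *-cancelʳ-nonNeg β>0 (subst (0ℚ ≤_) (axis-det-b t) (in-T⇒b-side apex-in-T))

    apex-below-AB : t * (α + β) ≤ D
    apex-below-AB = subst (_≤ D) (axis-det-AB t) (in-T⇒below-AB apex-in-T)

    excess≥0 : 0ℚ ≤ D - α * β
    excess≥0 = *-cancelʳ-nonNeg w>0 (subst (0ℚ ≤_) (*-comm w (D - α * β)) (*-cancelʳ-nonNeg β>0 Y-on-b-side))
      where
      Y-in-T′ : Hull (axis t) A* B (axis (w * (D - α * β)))
      Y-in-T′ = subst (Hull (axis t) A* B) (sym (axis-meets-A*B w≡))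
        (Hull-edge (axis t) A* B (<⇒≤ (*-pos w>0 β>0)) (<⇒≤ (*-pos w>0 α>0)) weights-sum)
      Y-on-b-side : 0ℚ ≤ w * (D - α * β) * β
      Y-on-b-side = subst (0ℚ ≤_) (axis-det-b (w * (D - α * β)))
        (in-T⇒b-side (axis-point-of-image onto (axis-det p ⟦ u ⟧ (w * (D - α * β))) Y-in-T′))

    p-in-T′ : Hull (axis t) A* B p
    p-in-T′ = axis-point-of-domain onto (det-origin p ⟦ u ⟧) (Hull-vertex p A B)

    Z-in-T′ : Hull (axis t) A* B (axis (w * D))
    Z-in-T′ = axis-point-of-domain onto (axis-det p ⟦ u ⟧ (w * D))
      (subst (Hull p A B) (sym (axis-meets-AB w≡)) (Hull-edge p A B (<⇒≤ (*-pos w>0 β>0)) (<⇒≤ (*-pos w>0 α>0)) weights-sum))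

    -- The functional det (_ ⊖ B) (B ⊖ A*) vanishes at A* and B, so on the triangle it has the
    -- sign of its value at the apex; but it is positive at Z and equal to α * β - D at p.
    excess≤0 : D - α * β ≤ 0ℚ
    excess≤0 = ≮⇒≥ excess-not-positive
      where
      Z-value : det (axis (w * D) ⊖ B) (B ⊖ A*) ≡ α * β
      Z-value = trans (axis-det-A*B (w * D)) (≡-modulo ((α + β) * w - 1ℚ) D (≡⇒difference-zero w≡) (lemma α β w D))
        where
        lemma : ∀ a b w d → w * d * (a + b) - (d - a * b) ≡ a * b + ((a + b) * w - 1ℚ) * d
        lemma = solve-∀ ℚ-ring
      A*-value : det (A* ⊖ B) (B ⊖ A*) ≡ 0ℚ
      A*-value = det-opposite A* B
      B-value : det (B ⊖ B) (B ⊖ A*) ≡ 0ℚ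
      B-value = det-origin B (B ⊖ A*)
      excess-not-positive : ¬ (0ℚ < D - α * β)
      excess-not-positive γ>0 with ≤-total (det (axis t ⊖ B) (B ⊖ A*)) 0ℚ
      ... | inj₁ apex≤0 = <-irrefl refl (<-≤-trans (*-pos α>0 β>0) (subst (_≤ 0ℚ) Z-value
            (Hull-det-≤ B (B ⊖ A*) apex≤0 (≤-reflexive A*-value) (≤-reflexive B-value) Z-in-T′)))
      ... | inj₂ apex≥0 = <-irrefl refl (<-≤-trans (neg-antimono-< γ>0) (subst (0ℚ ≤_) p-det-A*B
            (Hull-det-≥ B (B ⊖ A*) apex≥0 (≤-reflexive (sym A*-value)) (≤-reflexive (sym B-value)) p-in-T′)))

    D≡αβ : D ≡ α * β
    D≡αβ = difference-zero⇒≡ (≤-antisym excess≤0 excess≥0)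

    apex-on-AB : t * (α + β) ≡ D
    apex-on-AB = ≤-antisym apex-below-AB (begin
      D                      ≡⟨ lemma α β w D w≡ ⟩
      w * D * (α + β)        ≤⟨ *-monoʳ-≤-nonNeg (α + β) {{nonNegative (<⇒≤ α+β>0)}} wD≤t ⟩
      t * (α + β)            ∎)
      where
      open ≤-Reasoning
      lemma : ∀ a b w d → (a + b) * w ≡ 1ℚ → d ≡ w * d * (a + b)
      lemma a b w d w≡1 = ≡-modulo ((a + b) * w - 1ℚ) (- d) (≡⇒difference-zero w≡1) (solve (a ∷ b ∷ w ∷ d ∷ []) ℚ-ring)
      tβ≥0 : 0ℚ ≤ t * β
      tβ≥0 = *-nonNeg t≥0 (<⇒≤ β>0)
      wD≤t : w * D ≤ t
      wD≤t = *-cancelʳ-≤-pos β {{positive β>0}} (subst (_≤ t * β) (axis-det-b (w * D))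
        (Hull-det-≤ p (B ⊖ p) (≤-reflexive (axis-det-b t))
          (subst (_≤ t * β) (sym (trans A*-det-b (≡⇒difference-zero D≡αβ))) tβ≥0)
          (subst (_≤ t * β) (sym (det-self (B ⊖ p))) tβ≥0) Z-in-T′))

  module Bisectors {t t₀} (α>0 : 0ℚ < α) (β>0 : 0ℚ < β) (pu : Primitive u) (D≡αβ : D ≡ α * β) (apex-on-AB : t * (α + β) ≡ D)
                   (at-A : OnBisectorAt A B p (axis t₀)) (at-B : OnBisectorAt B p A (axis t₀)) where

    α+β>0 : 0ℚ < α + β
    α+β>0 = +-mono-< α>0 β>0

    A*-from-apex : A* ⊖ axis t ∝ φ u (A ⊖ B)
    A*-from-apex = ∝-by α+β>0 α>0 (apex-A*-side {t} apex-on-AB)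

    B-from-apex : B ⊖ axis t ∝ B ⊖ A
    B-from-apex = ∝-by α+β>0 β>0 (apex-B-side {t} apex-on-AB)

    p-between : β ∙ (A* ⊖ p) ≡ α ∙ (p ⊖ B)
    p-between = p-between-A*-B D≡αβ

    -- The sides at the apex run along φ u (A ⊖ B) and B ⊖ A.
    apex-bisector : OnBisectorAt (axis t) A* B (axis t₀)
    apex-bisector = from-side-AB at-B
      where
      from-side-AB : OnBisectorAt B p A (axis t₀) → OnBisectorAt (axis t) A* B (axis t₀)
      from-side-AB (_ , bisector {w = v} _ dBA@(direction _ (multiple r r>0 A-B≡)) _ _ , _) =
        neg u , sheared-straight-angle-bisector u pu dXA* dXB v-u>0 , t - t₀ , c-on-line
        where
        dXA* : Direction (axis t) A* (φℤ u v)
        dXA* = Direction-shear u dBA A*-from-apex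
        dXB : Direction (axis t) B (neg v)
        dXB = Direction-along (Direction-flip dBA) B-from-apex
        v-u>0 : 0ℚ < det ⟦ v ⟧ ⟦ u ⟧
        v-u>0 = *-cancelˡ-pos r>0 (subst (0ℚ <_) (begin
          α + β                ≡⟨ AB-det-k ⟨
          det (A ⊖ B) ⟦ u ⟧     ≡⟨ cong (λ x → det x ⟦ u ⟧) A-B≡ ⟩
          det (r ∙ ⟦ v ⟧) ⟦ u ⟧ ≡⟨ det-∙ˡ r ⟦ v ⟧ ⟦ u ⟧ ⟩
          r * det ⟦ v ⟧ ⟦ u ⟧   ∎) α+β>0)
          where open ≡-Reasoning
        c-on-line : axis t₀ ≡ axis t ⊕ ((t - t₀) · neg u)
        c-on-line = trans (axis-shift t t₀) (cong (λ x → axis t ⊕ (t - t₀) ∙ x) (sym (⟦⟧-neg u)))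

    -- The angle at A* is the shear image of the angle at A.
    A*-bisector : OnBisectorAt A* B (axis t) (axis t₀)
    A*-bisector = OnBisectorAt-swap (OnBisectorAt-shear u at-A (∝-reverse-shear ⟦ u ⟧ A* (axis t) A B A*-from-apex) B-side
      (axis-from-A* t₀))
      where
      p-from-A* : p ⊖ A* ≡ φ u (p ⊖ A)
      p-from-A* = subst (λ c → c ⊖ A* ≡ φ u (c ⊖ A)) axis-zero (axis-from-A* 0ℚ)
      B-side : B ⊖ A* ∝ φ u (p ⊖ A)
      B-side = subst (B ⊖ A* ∝_) p-from-A*
        (∝-by α>0 (+-mono-< β>0 α>0) (between-ratio β α B p A* (between-reverse α β A* p B p-between)))

    -- The sides at B still run along A ⊖ B and p ⊖ B.
    B-bisector : OnBisectorAt B (axis t) A* (axis t₀)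
    B-bisector = OnBisectorAt-along (OnBisectorAt-swap at-B) (∝-reverse B (axis t) B A B-from-apex)
      (∝-by β>0 α+β>0 (between-ratio α β A* p B p-between))

  mutated-barycentre : ∀ {t t₀} → PositiveCorner p A B u → Primitive u
    → MutatesOnto p A B u (axis t) (mutMap u p A) (mutMap u p B)
    → OnBisectorAt A B p (axis t₀) → OnBisectorAt B p A (axis t₀)
    → IsBarycentreOf (axis t) (mutMap u p A) (mutMap u p B) (axis t₀)
  mutated-barycentre {t} {t₀} (α>0 , β>0 , D>0) pu onto at-A at-B =
    subst₂ (λ A′ B′ → IsBarycentreOf (axis t) A′ B′ (axis t₀)) (sym (image-of-A α>0)) (sym (image-of-B β>0))
      (apex-bisector , A*-bisector , B-bisector)
    where
    onto′ : MutatesOnto p A B u (axis t) A* B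
    onto′ = subst₂ (MutatesOnto p A B u (axis t)) (image-of-A α>0) (image-of-B β>0) onto
    open Shape {t} α>0 β>0 D>0 onto′ using (D≡αβ; apex-on-AB)
    open Bisectors {t} {t₀} α>0 β>0 pu D≡αβ apex-on-AB at-A at-B

positive-corner : ∀ {p A B u v w} → Direction p A v → Direction p B w → ⟦ v ⟧ ⊕ ⟦ w ⟧ ∝ ⟦ u ⟧
  → 0ℚ < det ⟦ v ⟧ ⟦ w ⟧ → PositiveCorner p A B u
positive-corner {p} {A} {B} {u} {v} {w} (direction _ (multiple ρ ρ>0 a≡)) (direction _ (multiple σ σ>0 b≡)) (multiple r r>0 v+w≡) δ>0 =
  *-cancelˡ-pos r>0 (subst (0ℚ <_) (sym α-scaled) (*-pos ρ>0 δ>0)) ,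
  *-cancelˡ-pos r>0 (subst (0ℚ <_) (sym β-scaled) (*-pos σ>0 δ>0)) ,
  subst (0ℚ <_) (sym D-scaled) (*-pos (*-pos ρ>0 σ>0) δ>0)
  where
  open ≡-Reasoning
  V W k : Pt
  V = ⟦ v ⟧
  W = ⟦ w ⟧
  k = ⟦ u ⟧
  det-with-sumʳ : ∀ ρ x y → det (ρ ∙ x) (x ⊕ y) ≡ ρ * det x y
  det-with-sumʳ ρ (pt x₁ x₂) (pt y₁ y₂) = lemma ρ x₁ x₂ y₁ y₂
    where
    lemma : ∀ ρ x₁ x₂ y₁ y₂ → ρ * x₁ * (x₂ + y₂) - ρ * x₂ * (x₁ + y₁) ≡ ρ * (x₁ * y₂ - x₂ * y₁)
    lemma = solve-∀ ℚ-ring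
  det-with-sumˡ : ∀ σ x y → det (x ⊕ y) (σ ∙ y) ≡ σ * det x y
  det-with-sumˡ σ (pt x₁ x₂) (pt y₁ y₂) = lemma σ x₁ x₂ y₁ y₂
    where
    lemma : ∀ σ x₁ x₂ y₁ y₂ → (x₁ + y₁) * (σ * y₂) - (x₂ + y₂) * (σ * y₁) ≡ σ * (x₁ * y₂ - x₂ * y₁)
    lemma = solve-∀ ℚ-ring
  α-scaled : r * det (A ⊖ p) k ≡ ρ * det V W
  α-scaled = begin
    r * det (A ⊖ p) k       ≡⟨ det-∙ʳ r (A ⊖ p) k ⟨
    det (A ⊖ p) (r ∙ k)     ≡⟨ cong₂ det a≡ (sym v+w≡) ⟩
    det (ρ ∙ V) (V ⊕ W)     ≡⟨ det-with-sumʳ ρ V W ⟩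
    ρ * det V W             ∎
  β-scaled : r * det k (B ⊖ p) ≡ σ * det V W
  β-scaled = begin
    r * det k (B ⊖ p)       ≡⟨ det-∙ˡ r k (B ⊖ p) ⟨
    det (r ∙ k) (B ⊖ p)     ≡⟨ cong₂ det (sym v+w≡) b≡ ⟩
    det (V ⊕ W) (σ ∙ W)     ≡⟨ det-with-sumˡ σ V W ⟩
    σ * det V W             ∎
  D-scaled : det (A ⊖ p) (B ⊖ p) ≡ ρ * σ * det V W
  D-scaled = begin
    det (A ⊖ p) (B ⊖ p)     ≡⟨ cong₂ det a≡ b≡ ⟩
    det (ρ ∙ V) (σ ∙ W)     ≡⟨ det-∙ˡ ρ V (σ ∙ W) ⟩
    ρ * det V (σ ∙ W)       ≡⟨ cong (ρ *_) (det-∙ʳ σ V W) ⟩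
    ρ * (σ * det V W)       ≡⟨ *-assoc ρ σ (det V W) ⟨
    ρ * σ * det V W         ∎

-- A lies strictly between p and B, where the angle is straight.
between-has-no-bisector : ∀ {p A B u v ρ σ} → Primitive v → 0ℚ < ρ → ρ < σ
  → A ⊖ p ≡ ρ ∙ ⟦ v ⟧ → B ⊖ p ≡ σ ∙ ⟦ v ⟧ → ¬ Bisector A B p u
between-has-no-bisector {p} {A} {B} {v = v} {ρ} {σ} pv ρ>0 ρ<σ a≡ b≡ =
  straight-angle-has-no-bisector {v = v} (direction pv (multiple (σ - ρ) σ-ρ>0 B-A≡)) (Direction-flip {v = v} (direction pv (multiple ρ ρ>0 a≡)))
  where
  σ-ρ>0 : 0ℚ < σ - ρ
  σ-ρ>0 = subst (_< σ - ρ) (+-inverseʳ ρ) (+-monoˡ-< (- ρ) ρ<σ)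
  difference : ∀ p A B → B ⊖ A ≡ (B ⊖ p) ⊕ (- 1ℚ) ∙ (A ⊖ p)
  difference (pt p₁ p₂) (pt a₁ a₂) (pt b₁ b₂) = pt-≡ (coordinate p₁ a₁ b₁) (coordinate p₂ a₂ b₂)
    where
    coordinate : ∀ p a b → b - a ≡ b - p + - 1ℚ * (a - p)
    coordinate = solve-∀ ℚ-ring
  collect : ∀ x → σ ∙ x ⊕ (- 1ℚ) ∙ ρ ∙ x ≡ (σ - ρ) ∙ x
  collect (pt x₁ x₂) = pt-≡ (coordinate x₁) (coordinate x₂)
    where
    coordinate : ∀ x → σ * x + - 1ℚ * (ρ * x) ≡ (σ - ρ) * x
    coordinate x = solve (ρ ∷ σ ∷ x ∷ []) ℚ-ring
  B-A≡ : B ⊖ A ≡ (σ - ρ) ∙ ⟦ v ⟧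
  B-A≡ = trans (difference p A B) (trans (cong₂ (λ x y → x ⊕ (- 1ℚ) ∙ y) b≡ a≡) (collect ⟦ v ⟧))

same-ray-has-no-barycentre : ∀ {p A B v c} → Direction p A v → Direction p B v
  → OnBisectorAt A B p c → OnBisectorAt B p A c → ⊥
same-ray-has-no-barycentre {p} {A} {B} {v} (direction pv (multiple ρ ρ>0 a≡)) (direction _ (multiple σ σ>0 b≡))
  (_ , bis-A , _) (_ , bis-B , _) = by-position (<-cmp ρ σ)
  where
  by-position : Trichotomy (ρ < σ) (ρ ≡ σ) (σ < ρ) → ⊥
  by-position (tri< ρ<σ _ _) = between-has-no-bisector {v = v} pv ρ>0 ρ<σ a≡ b≡ bis-A
  by-position (tri> _ _ σ<ρ) = between-has-no-bisector {v = v} pv σ>0 σ<ρ b≡ a≡ (Bisector-swap bis-B)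
  by-position (tri≈ _ ρ≡σ _) = Direction-irreflexive (subst (λ X → Direction A X _) (sym A≡B) (Bisector.toR bis-A))
    where
    A≡B : A ≡ B
    A≡B = begin
      A                ≡⟨ ⊖-⊕-cancel p A ⟨
      p ⊕ (A ⊖ p)      ≡⟨ cong (p ⊕_) (trans a≡ (trans (cong (_∙ ⟦ v ⟧) ρ≡σ) (sym b≡))) ⟩
      p ⊕ (B ⊖ p)      ≡⟨ ⊖-⊕-cancel p B ⟩
      B                ∎
      where open ≡-Reasoning

MutatesOnto-swap : ∀ {p A B u X A′ B′} → MutatesOnto p A B u X A′ B′ → MutatesOnto p B A u X B′ A′
MutatesOnto-swap onto x = mk⇔
  (λ x∈ → swap-preimage (Equivalence.to (onto x) (Hull-swap x∈)))
  (λ { (y , y∈ , x≡My) → Hull-swap (Equivalence.from (onto x) (y , Hull-swap y∈ , x≡My)) })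
  where
  swap-preimage : ∀ {p A B u x} → ∃[ y ] (Hull p A B y × x ≡ mutMap u p y) → ∃[ y ] (Hull p B A y × x ≡ mutMap u p y)
  swap-preimage (y , y∈ , x≡My) = y , Hull-swap y∈ , x≡My

-- Mutation preserves the barycentre

on-bisector-line : ∀ {p A B u c} → Bisector p A B u → OnBisectorAt p A B c → ∃[ t₀ ] (c ≡ p ⊕ (t₀ · u))
on-bisector-line {p} {c = c} bis (u′ , bis′ , t₀ , c≡) = t₀ , subst (λ e → c ≡ p ⊕ (t₀ · e)) (Bisector-unique bis′ bis) c≡

mutation-preserves-barycentre : ∀ {p A B u t X A′ B′ c} → Bisector p A B u
  → X ≡ p ⊕ (t · u) → A′ ≡ mutMap u p A → B′ ≡ mutMap u p B → MutatesOnto p A B u X A′ B′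
  → IsBarycentreOf p A B c → IsBarycentreOf X A′ B′ c
mutation-preserves-barycentre {p} {A} {B} {u} {t} {c = c} bis@(bisector {v} {w} dA dB pu v+w∝u) refl refl refl onto (at-p , at-A , at-B) =
  subst (IsBarycentreOf (p ⊕ (t · u)) (mutMap u p A) (mutMap u p B)) (sym c≡) (by-orientation (<-cmp 0ℚ (det ⟦ v ⟧ ⟦ w ⟧)))
  where
  t₀ : ℚ
  t₀ = proj₁ (on-bisector-line bis at-p)
  c≡ : c ≡ p ⊕ (t₀ · u)
  c≡ = proj₂ (on-bisector-line bis at-p)
  at-A′ : OnBisectorAt A B p (p ⊕ (t₀ · u))
  at-A′ = subst (OnBisectorAt A B p) c≡ at-A
  at-B′ : OnBisectorAt B p A (p ⊕ (t₀ · u))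
  at-B′ = subst (OnBisectorAt B p A) c≡ at-B
  by-orientation : Trichotomy (0ℚ < det ⟦ v ⟧ ⟦ w ⟧) (0ℚ ≡ det ⟦ v ⟧ ⟦ w ⟧) (det ⟦ v ⟧ ⟦ w ⟧ < 0ℚ)
    → IsBarycentreOf (p ⊕ (t · u)) (mutMap u p A) (mutMap u p B) (p ⊕ (t₀ · u))
  by-orientation (tri< vw>0 _ _) =
    Corner.mutated-barycentre p A B u {t} {t₀} (positive-corner {u = u} dA dB v+w∝u vw>0) pu onto at-A′ at-B′
  by-orientation (tri> _ _ vw<0) = IsBarycentreOf-swap
    (Corner.mutated-barycentre p B A u {t} {t₀} (positive-corner {u = u} dB dA (Bisector.sum (Bisector-swap bis)) wv>0) pu
      (MutatesOnto-swap onto) (OnBisectorAt-swap at-B′) (OnBisectorAt-swap at-A′))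
    where
    wv>0 : 0ℚ < det ⟦ w ⟧ ⟦ v ⟧
    wv>0 = subst (0ℚ <_) (sym (det-antisym ⟦ w ⟧ ⟦ v ⟧)) (neg-antimono-< vw<0)
  by-orientation (tri≈ _ 0≡vw _) = ⊥-elim (degenerate (Primitive-parallel {v} {w} (Direction.is-primitive dA) (Direction.is-primitive dB) (sym 0≡vw)))
    where
    degenerate : w ≡ v ⊎ w ≡ neg v → ⊥
    degenerate (inj₁ w≡v) = same-ray-has-no-barycentre dA (subst (Direction p B) w≡v dB) at-A at-B
    degenerate (inj₂ w≡-v) = straight-angle-has-no-bisector {v = v} dA (subst (Direction p B) w≡-v dB) bis

nxt-moves : ∀ i → nxt i ≢ i
nxt-moves zero ()
nxt-moves (suc zero) ()
nxt-moves (suc (suc zero)) ()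

nxt²-moves : ∀ i → nxt (nxt i) ≢ i
nxt²-moves zero ()
nxt²-moves (suc zero) ()
nxt²-moves (suc (suc zero)) ()

Dir⇒Direction : ∀ {P Q v} → Dir P Q v → Direction P Q v
Dir⇒Direction (pv , r , r>0 , Q-P≡) = direction pv (multiple r r>0 Q-P≡)

Direction⇒Dir : ∀ {P Q v} → Direction P Q v → Dir P Q v
Direction⇒Dir (direction pv (multiple r r>0 Q-P≡)) = pv , r , r>0 , Q-P≡

sum-of-directions : ∀ v w → 1ℚ · (v +v w) ≡ ⟦ v ⟧ ⊕ ⟦ w ⟧
sum-of-directions v w = trans (∙-identity ⟦ v +v w ⟧) (⟦⟧-+v v w)

BisVec⇒Bisector : ∀ T i {u} → BisVec T i u → Bisector (T i) (T (nxt i)) (T (nxt (nxt i))) u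
BisVec⇒Bisector T i (v , w , dv , dw , pu , r , r>0 , v+w≡) =
  bisector {v = v} {w = w} (Dir⇒Direction dv) (Dir⇒Direction dw) pu (multiple r r>0 (trans (sym (sum-of-directions v w)) v+w≡))

Bisector⇒BisVec : ∀ T i {u} → Bisector (T i) (T (nxt i)) (T (nxt (nxt i))) u → BisVec T i u
Bisector⇒BisVec T i (bisector {v} {w} dv dw pu (multiple r r>0 v+w≡)) =
  v , w , Direction⇒Dir dv , Direction⇒Dir dw , pu , r , r>0 , trans (sum-of-directions v w) v+w≡

IsBarycentre⇔IsBarycentreOf : ∀ T i {c} → IsBarycentre T c ⇔ IsBarycentreOf (T i) (T (nxt i)) (T (nxt (nxt i))) c
IsBarycentre⇔IsBarycentreOf T zero = mk⇔ corners labels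
  where
  corner : ∀ i {c} → OnBisector T i c → OnBisectorAt (T i) (T (nxt i)) (T (nxt (nxt i))) c
  corner i (u , bis , on-line) = u , BisVec⇒Bisector T i bis , on-line
  label : ∀ i {c} → OnBisectorAt (T i) (T (nxt i)) (T (nxt (nxt i))) c → OnBisector T i c
  label i (u , bis , on-line) = u , Bisector⇒BisVec T i bis , on-line
  corners : ∀ {c} → IsBarycentre T c → IsBarycentreOf (T zero) (T (suc zero)) (T (suc (suc zero))) c
  corners bary = corner zero (bary zero) , corner (suc zero) (bary (suc zero)) , corner (suc (suc zero)) (bary (suc (suc zero)))
  labels : ∀ {c} → IsBarycentreOf (T zero) (T (suc zero)) (T (suc (suc zero))) c → IsBarycentre T c
  labels (at₀ , _ , _) zero = label zero at₀
  labels (_ , at₁ , _) (suc zero) = label (suc zero) at₁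
  labels (_ , _ , at₂) (suc (suc zero)) = label (suc (suc zero)) at₂
IsBarycentre⇔IsBarycentreOf T (suc zero) =
  mk⇔ (IsBarycentreOf-rotate ∘ Equivalence.to (IsBarycentre⇔IsBarycentreOf T zero))
  (Equivalence.from (IsBarycentre⇔IsBarycentreOf T zero) ∘ IsBarycentreOf-rotate ∘ IsBarycentreOf-rotate)
IsBarycentre⇔IsBarycentreOf T (suc (suc zero)) =
  mk⇔ (IsBarycentreOf-rotate ∘ IsBarycentreOf-rotate ∘ Equivalence.to (IsBarycentre⇔IsBarycentreOf T zero))
  (Equivalence.from (IsBarycentre⇔IsBarycentreOf T zero) ∘ IsBarycentreOf-rotate)

InTri⇔Hull : ∀ T i {x} → InTri T x ⇔ Hull (T i) (T (nxt i)) (T (nxt (nxt i))) x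
InTri⇔Hull T zero = mk⇔ (InTri⇒Hull T) (Hull⇒InTri T)
InTri⇔Hull T (suc zero) = mk⇔ (Hull-rotate ∘ InTri⇒Hull T) (Hull⇒InTri T ∘ Hull-rotate ∘ Hull-rotate)
InTri⇔Hull T (suc (suc zero)) = mk⇔ (Hull-rotate ∘ Hull-rotate ∘ InTri⇒Hull T) (Hull⇒InTri T ∘ Hull-rotate)

image⇒MutatesOnto : ∀ T i T′ {u} → (∀ x → InTri T′ x ⇔ (∃[ y ] (InTri T y × x ≡ mutMap u (T i) y)))
  → MutatesOnto (T i) (T (nxt i)) (T (nxt (nxt i))) u (T′ i) (T′ (nxt i)) (T′ (nxt (nxt i)))
image⇒MutatesOnto T i T′ image x = mk⇔
  (λ x∈ → to-corner (Equivalence.to (image x) (Equivalence.from (InTri⇔Hull T′ i) x∈)))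
  (λ { (y , y∈ , x≡My) → Equivalence.to (InTri⇔Hull T′ i) (Equivalence.from (image x) (y , Equivalence.from (InTri⇔Hull T i) y∈ , x≡My)) })
  where
  to-corner : ∀ {u} → ∃[ y ] (InTri T y × x ≡ mutMap u (T i) y) → ∃[ y ] (Hull (T i) (T (nxt i)) (T (nxt (nxt i))) y × x ≡ mutMap u (T i) y)
  to-corner (y , y∈ , x≡My) = y , Equivalence.to (InTri⇔Hull T i) y∈ , x≡My

mainTheorem12 : (T : Tri) (q : Fin 3 → ℕ) → MarkovTriangle T q
                → (β : Pt) → IsBarycentre T β
                → (i : Fin 3) (T' : Tri) → IsMutation T i T' → IsBarycentre T' β
mainTheorem12 T _ _ β bary i T′ (u , bis , moved , (t , apex) , image) =
  Equivalence.from (IsBarycentre⇔IsBarycentreOf T′ i)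
    (mutation-preserves-barycentre {t = t} (BisVec⇒Bisector T i bis) apex (moved (nxt i) (nxt-moves i)) (moved (nxt (nxt i)) (nxt²-moves i))
      (image⇒MutatesOnto T i T′ image) (Equivalence.to (IsBarycentre⇔IsBarycentreOf T i) bary))
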